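{- Let $r\ge1$ and let $a_1,\dots,a_r$ be nonzero complex numbers. For integers $n,m$ with $n-1\ge m\ge1$, \begin{align*} &\sum_{l=0}^{n-m}\binom{n}{l}S_1(n-l,m)D_l(a_1,\dots,a_r) =\sum_{l=0}^{n-m}\binom{n-1}{l}S_1(n-l-1,m-1)D_l(-1|a_1,\dots,a_r)\\ &\quad+\frac1n\sum_{l=0}^{n-m-1}\binom{n}{l+1}S_1(n-l-1,m)\left(r\sum_{i=0}^{l+1}\binom{l+1}{i}c_iD_{l+1-i}(-1|a_1,\dots,a_r)-\sum_{j=1}^r\sum_{i=0}^{l+1}\binom{l+1}{i}a_jc_iD_{l+1-i}(a_j-1|a_1,\dots,a_r,a_j)\right), \end{align*} and \begin{align*} &\sum_{l=0}^{n-m}\binom{n}{l}S_1(n-l,m)\widehat D_l(a_1,\dots,a_r) =\sum_{l=0}^{n-m}\binom{n-1}{l}S_1(n-l-1,m-1)\widehat D_l(-1|a_1,\dots,a_r)\\ &\quad+\frac1n\sum_{l=0}^{n-m-1}\binom{n}{l+1}S_1(n-l-1,m)\left(r\sum_{i=0}^{l+1}\binom{l+1}{i}c_i\widehat D_{l+1-i}(-1|a_1,\dots,a_r)-\sum_{j=1}^r\sum_{i=0}^{l+1}\binom{l+1}{i}a_jc_i\widehat D_{l+1-i}(-1|a_1,\dots,a_r,a_j)\right)\\ &\quad+\sum_{l=0}^{n-m-1}\binom{n-1}{l}S_1(n-l-1,m)\sum_{j=1}^ra_j\widehat D_l(-1|a_1,\dots,a_r). \end{align*}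
   Context: For any $k\ge1$ and nonzero complex $b_1,\dots,b_k$, the Barnes-type Daehee polynomials of the first and second kind are defined by the formal power series identities $\prod_{j=1}^k\frac{\ln(1+t)}{(1+t)^{b_j}-1}(1+t)^x=\sum_{n\ge0}D_n(x|b_1,\dots,b_k)\frac{t^n}{n!}$ and $\prod_{j=1}^k\frac{(1+t)^{b_j}\ln(1+t)}{(1+t)^{b_j}-1}(1+t)^x=\sum_{n\ge0}\widehat D_n(x|b_1,\dots,b_k)\frac{t^n}{n!}$; the numbers are $D_n(b_1,\dots,b_k)=D_n(0|b_1,\dots,b_k)$, $\widehat D_n(b_1,\dots,b_k)=\widehat D_n(0|b_1,\dots,b_k)$. In the claim, $(a_1,\dots,a_r,a_j)$ denotes the list of $r+1$ parameters obtained by appending $a_j$ once more. $S_1(n,m)$ are the signed Stirling numbers of the first kind: $x(x-1)\cdots(x-n+1)=\sum_{m=0}^nS_1(n,m)x^m$. The Cauchy numbers $c_n$ are defined by $\frac{t}{\ln(1+t)}=\sum_{n\ge0}c_n\frac{t^n}{n!}$. -}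

module Defs where

open import Level using (Level; _⊔_) renaming (suc to lsuc)
open import Algebra.Bundles using (CommutativeRing)
open import Data.Nat as ℕ using (ℕ; zero; suc; _∸_; _!)
open import Data.Nat.Combinatorics using (_C_)
open import Data.Integer as ℤ using (ℤ; +_; -[1+_])
open import Data.List using (List; []; _∷_; map; foldr)
open import Relation.Nullary using (¬_)

-- Signed Stirling numbers of the first kind.
-- fallPoly n is the coefficient function of the integer polynomial
-- x(x-1)...(x-n+1); it is built by multiplying by (x - n) at each step:
-- coefficients of p·(x - n) = (x·p) - n·p.

xTimes : (ℕ → ℤ) → ℕ → ℤ
xTimes p zero    = + 0
xTimes p (suc m) = p m

fallPoly : ℕ → ℕ → ℤ
fallPoly zero zero    = + 1
fallPoly zero (suc m) = + 0
fallPoly (suc n) m    = xTimes (fallPoly n) m ℤ.- (+ n) ℤ.* fallPoly n m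

S₁ : ℕ → ℕ → ℤ
S₁ n m = fallPoly n m

-- A field of characteristic zero (the paper works over ℂ, which agda-stdlib
-- does not provide).  The inverse is a total function whose
-- value at 0 is unspecified junk; it is only ever applied to nonzero elements.

ringFromℕ : ∀ {c ℓ} (R : CommutativeRing c ℓ) → ℕ → CommutativeRing.Carrier R
ringFromℕ R zero    = CommutativeRing.0# R
ringFromℕ R (suc n) = CommutativeRing._+_ R (CommutativeRing.1# R) (ringFromℕ R n)

record CharZeroField (c ℓ : Level) : Set (lsuc (c ⊔ ℓ)) where
  field
    commRing : CommutativeRing c ℓ
  open CommutativeRing commRing public

  fromℕ : ℕ → Carrier
  fromℕ = ringFromℕ commRing

  field
    _⁻¹        : Carrier → Carrier
    ⁻¹-inverse : ∀ x → ¬ (x ≈ 0#) → x * (x ⁻¹) ≈ 1#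
    charZero   : ∀ n → ¬ (ringFromℕ commRing (suc n) ≈ 0#)

module FieldDefs {c ℓ : Level} (F : CharZeroField c ℓ) where
  open CharZeroField F public

  fromℤ : ℤ → Carrier
  fromℤ (+ n)      = fromℕ n
  fromℤ -[1+ n ]   = - fromℕ (suc n)

  sumTo : ℕ → (ℕ → Carrier) → Carrier
  sumTo zero    f = 0#
  sumTo (suc n) f = sumTo n f + f n

  sumList : List Carrier → Carrier
  sumList = foldr _+_ 0#

  PS : Set c
  PS = ℕ → Carrier

  onePS : PS
  onePS zero    = 1#
  onePS (suc n) = 0#

  _⊛_ : PS → PS → PS
  (f ⊛ g) n = sumTo (suc n) (λ k → f k * g (n ∸ k))

  prodPS : List PS → PS
  prodPS = foldr _⊛_ onePS

  -- division by t (for series with zero constant term)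
  divT : PS → PS
  divT f n = f (suc n)

  -- multiplicative inverse of a series with invertible constant term:
  -- h₀ = g₀⁻¹,  h_{n+1} = - g₀⁻¹ Σ_{k=1}^{n+1} g_k h_{n+1-k}.
  -- invList g n = h_n ∷ h_{n-1} ∷ ... ∷ h_0
  convAux : PS → ℕ → List Carrier → Carrier
  convAux g j []       = 0#
  convAux g j (h ∷ hs) = g (suc j) * h + convAux g (suc j) hs

  invList : PS → ℕ → List Carrier
  invList g zero    = (g 0 ⁻¹) ∷ []
  invList g (suc n) = (- (g 0 ⁻¹ * convAux g 0 (invList g n))) ∷ invList g n

  headOr0 : List Carrier → Carrier
  headOr0 []      = 0#
  headOr0 (h ∷ _) = h

  invPS : PS → PS
  invPS g n = headOr0 (invList g n)

  falling : Carrier → ℕ → Carrier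
  falling x zero    = 1#
  falling x (suc n) = falling x n * (x - fromℕ n)

  fact : ℕ → Carrier
  fact n = fromℕ (n !)

  -- (1+t)^x = Σ_n binom(x,n) t^n
  pow1t : Carrier → PS
  pow1t x n = falling x n * (fact n ⁻¹)

  -- ln(1+t) = Σ_{n≥1} (-1)^{n-1} t^n / n
  sgn : ℕ → Carrier
  sgn zero    = 1#
  sgn (suc n) = - sgn n

  logPS : PS
  logPS zero    = 0#
  logPS (suc n) = sgn n * (fromℕ (suc n) ⁻¹)

  -- ln(1+t) / ((1+t)^b - 1)
  factor : Carrier → PS
  factor b = divT logPS ⊛ invPS (divT (λ n → pow1t b n - onePS n))

  factorHat : Carrier → PS
  factorHat b = pow1t b ⊛ factor b

  D : ℕ → Carrier → List Carrier → Carrier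
  D n x bs = fact n * (prodPS (map factor bs) ⊛ pow1t x) n

  Dhat : ℕ → Carrier → List Carrier → Carrier
  Dhat n x bs = fact n * (prodPS (map factorHat bs) ⊛ pow1t x) n

  -- Cauchy numbers: t / ln(1+t) = Σ c_n t^n / n!
  cauchy : ℕ → Carrier
  cauchy n = fact n * invPS (divT logPS) n

  binom : ℕ → ℕ → Carrier
  binom n k = fromℕ (n C k)

  s1 : ℕ → ℕ → Carrier
  s1 n m = fromℤ (S₁ n m)

module Submission where

-- Let Φ = Π_j ln(1+t)/((1+t)^{a_j} - 1), so that D_l(x|a) = l!·[t^l] Φ·(1+t)^x
-- (and likewise Φ̂ for the second kind).  Two facts about Φ give the theorem:
--   (i)  Φ = (Φ·(1+t)^(-1))·(1+t), relating D_l(0|a) to D_l(-1|a);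
--   (ii) the Euler derivative θ = t·d/dt satisfies θΦ = Φ·Σ_j Q_{a_j}, which
--        expresses (l+1)·D_{l+1}(0|a) through Cauchy numbers and the values
--        D(-1|a), D(a_j - 1|a,a_j): the bracket of the theorem.
-- A combinatorial identity (StirlingTransfer), built from the recurrence of S₁,
-- Pascal's rule and absorption, turns (i) and (ii) into the stated identity.

open import Level using (Level)
open import Algebra.Bundles using (CommutativeRing; RawRing)
open import Data.Nat as ℕ using (ℕ; zero; suc; _∸_; _≤_; s≤s; _!)
import Data.Nat.Properties as ℕ
open import Data.Nat.Combinatorics using (nCk+nC[k+1]≡[n+1]C[k+1]) renaming (_C_ to _choose_)
open import Data.Integer as ℤ using (ℤ; +_; -[1+_])
import Data.Integer.Properties as ℤ
open import Data.Sign as Sign using (Sign)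
open import Data.Maybe using (Maybe; just; nothing)
open import Data.List using (List; []; _∷_; map; length; _++_; [_])
open import Data.List.Relation.Unary.All using (All; []; _∷_)
open import Data.Product using (_×_; _,_)
open import Relation.Nullary using (¬_; yes; no)
import Relation.Binary.PropositionalEquality as ≡
open import Defs

-- The canonical maps ℕ → R and ℤ → R into any commutative ring are ring
-- homomorphisms.  This lets the standard library's ring solver work with
-- integer coefficients on rings without decidable equality.
module IntegerCoefficientSolver {c ℓ : Level} (R : CommutativeRing c ℓ) where
  open CommutativeRing R
  open import Relation.Binary.Reasoning.Setoid setoid
  open import Algebra.Properties.Ring ring
    using (-‿distribˡ-*; -‿involutive; -0#≈0#; -‿+-comm; x≈y⇒x∙y⁻¹≈ε)
  open import Algebra.Properties.Monoid.Mult +-monoid using (×-homo-+) renaming (_×_ to _×ₙ_)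
  open import Algebra.Properties.Semiring.Mult semiring using (×1-homo-*)
  open import Algebra.Solver.Ring.AlmostCommutativeRing
    using (AlmostCommutativeRing; fromCommutativeRing; _-Raw-AlmostCommutative⟶_)

  -- n ↦ 1 + ... + 1; it agrees with the library's n × 1#, whose homomorphism
  -- properties we reuse
  ℕ→R : ℕ → Carrier
  ℕ→R = ringFromℕ R

  ℕ→R≈× : ∀ n → ℕ→R n ≈ n ×ₙ 1#
  ℕ→R≈× zero    = refl
  ℕ→R≈× (suc n) = +-congˡ (ℕ→R≈× n)

  ℕ→R-+ : ∀ m n → ℕ→R (m ℕ.+ n) ≈ ℕ→R m + ℕ→R n
  ℕ→R-+ m n = begin
    ℕ→R (m ℕ.+ n)          ≈⟨ ℕ→R≈× (m ℕ.+ n) ⟩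
    (m ℕ.+ n) ×ₙ 1#         ≈⟨ ×-homo-+ 1# m n ⟩
    m ×ₙ 1# + n ×ₙ 1#        ≈⟨ +-cong (ℕ→R≈× m) (ℕ→R≈× n) ⟨
    ℕ→R m + ℕ→R n          ∎

  ℕ→R-* : ∀ m n → ℕ→R (m ℕ.* n) ≈ ℕ→R m * ℕ→R n
  ℕ→R-* m n = begin
    ℕ→R (m ℕ.* n)          ≈⟨ ℕ→R≈× (m ℕ.* n) ⟩
    (m ℕ.* n) ×ₙ 1#         ≈⟨ ×1-homo-* m n ⟩
    (m ×ₙ 1#) * (n ×ₙ 1#)    ≈⟨ *-cong (ℕ→R≈× m) (ℕ→R≈× n) ⟨
    ℕ→R m * ℕ→R n          ∎

  ℤ→R : ℤ → Carrier
  ℤ→R (+ n)    = ℕ→R n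
  ℤ→R -[1+ n ] = - ℕ→R (suc n)

  ℤ→R-neg : ∀ i → ℤ→R (ℤ.- i) ≈ - ℤ→R i
  ℤ→R-neg (+ zero)  = sym -0#≈0#
  ℤ→R-neg (+ suc n) = refl
  ℤ→R-neg -[1+ n ]  = sym (-‿involutive _)

  sub-shift : ∀ x y → x - y ≈ (1# + x) - (1# + y)
  sub-shift x y = begin
    x - y                        ≈⟨ +-identityˡ _ ⟨
    0# + (x - y)                 ≈⟨ +-congʳ (x≈y⇒x∙y⁻¹≈ε refl) ⟨
    (1# - 1#) + (x - y)          ≈⟨ +-assoc 1# (- 1#) (x - y) ⟩
    1# + (- 1# + (x - y))        ≈⟨ +-congˡ (+-assoc (- 1#) x (- y)) ⟨
    1# + ((- 1# + x) - y)        ≈⟨ +-congˡ (+-congʳ (+-comm (- 1#) x)) ⟩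
    1# + ((x - 1#) - y)          ≈⟨ +-congˡ (+-assoc x (- 1#) (- y)) ⟩
    1# + (x + (- 1# - y))        ≈⟨ +-congˡ (+-congˡ (-‿+-comm 1# y)) ⟩
    1# + (x - (1# + y))          ≈⟨ +-assoc 1# x (- (1# + y)) ⟨
    (1# + x) - (1# + y)          ∎

  ℤ→R-⊖ : ∀ m n → ℤ→R (m ℤ.⊖ n) ≈ ℕ→R m - ℕ→R n
  ℤ→R-⊖ zero    zero    = sym (-‿inverseʳ 0#)
  ℤ→R-⊖ zero    (suc n) = sym (+-identityˡ _)
  ℤ→R-⊖ (suc m) zero    = sym (trans (+-congˡ -0#≈0#) (+-identityʳ _))
  ℤ→R-⊖ (suc m) (suc n) = begin
    ℤ→R (suc m ℤ.⊖ suc n)        ≡⟨ ≡.cong ℤ→R (ℤ.[1+m]⊖[1+n]≡m⊖n m n) ⟩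
    ℤ→R (m ℤ.⊖ n)                ≈⟨ ℤ→R-⊖ m n ⟩
    ℕ→R m - ℕ→R n                ≈⟨ sub-shift (ℕ→R m) (ℕ→R n) ⟩
    ℕ→R (suc m) - ℕ→R (suc n)    ∎

  ℤ→R-+ : ∀ i j → ℤ→R (i ℤ.+ j) ≈ ℤ→R i + ℤ→R j
  ℤ→R-+ -[1+ m ] -[1+ n ] = begin
    - (1# + ℕ→R (suc (m ℕ.+ n)))       ≈⟨ -‿cong (+-congˡ (ℕ→R-+ (suc m) n)) ⟩
    - (1# + (ℕ→R (suc m) + ℕ→R n))     ≈⟨ -‿cong (+-congˡ (+-comm _ _)) ⟩
    - (1# + (ℕ→R n + ℕ→R (suc m)))     ≈⟨ -‿cong (+-assoc 1# _ _) ⟨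
    - (ℕ→R (suc n) + ℕ→R (suc m))      ≈⟨ -‿+-comm _ _ ⟨
    - ℕ→R (suc n) - ℕ→R (suc m)        ≈⟨ +-comm _ _ ⟩
    - ℕ→R (suc m) - ℕ→R (suc n)        ∎
  ℤ→R-+ -[1+ m ] (+ n)    = trans (ℤ→R-⊖ n (suc m)) (+-comm _ _)
  ℤ→R-+ (+ m)    -[1+ n ] = ℤ→R-⊖ m (suc n)
  ℤ→R-+ (+ m)    (+ n)    = ℕ→R-+ m n

  -- multiplicativity is proved through the sign–absolute value decomposition
  signR : Sign → Carrier
  signR Sign.+ = 1#
  signR Sign.- = - 1#

  signR-* : ∀ s t → signR (s Sign.* t) ≈ signR s * signR t
  signR-* Sign.- Sign.- = sym (trans (sym (-‿distribˡ-* 1# (- 1#)))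
                                 (trans (-‿cong (*-identityˡ _)) (-‿involutive _)))
  signR-* Sign.- Sign.+ = sym (*-identityʳ _)
  signR-* Sign.+ t      = sym (*-identityˡ _)

  ℤ→R-◃ : ∀ s n → ℤ→R (s ℤ.◃ n) ≈ signR s * ℕ→R n
  ℤ→R-◃ s        zero    = sym (zeroʳ _)
  ℤ→R-◃ Sign.-   (suc n) = trans (-‿cong (sym (*-identityˡ _))) (-‿distribˡ-* _ _)
  ℤ→R-◃ Sign.+   (suc n) = sym (*-identityˡ _)

  ℤ→R-sign-abs : ∀ i → ℤ→R i ≈ signR (ℤ.sign i) * ℕ→R ℤ.∣ i ∣
  ℤ→R-sign-abs i = trans (reflexive (≡.cong ℤ→R (≡.sym (ℤ.◃-inverse i)))) (ℤ→R-◃ (ℤ.sign i) ℤ.∣ i ∣)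

  interchange : ∀ a b x y → (a * b) * (x * y) ≈ (a * x) * (b * y)
  interchange a b x y = begin
    (a * b) * (x * y)   ≈⟨ *-assoc a b (x * y) ⟩
    a * (b * (x * y))   ≈⟨ *-congˡ (*-assoc b x y) ⟨
    a * ((b * x) * y)   ≈⟨ *-congˡ (*-congʳ (*-comm b x)) ⟩
    a * ((x * b) * y)   ≈⟨ *-congˡ (*-assoc x b y) ⟩
    a * (x * (b * y))   ≈⟨ *-assoc a x (b * y) ⟨
    (a * x) * (b * y)   ∎

  ℤ→R-* : ∀ i j → ℤ→R (i ℤ.* j) ≈ ℤ→R i * ℤ→R j
  ℤ→R-* i j = begin
    ℤ→R (i ℤ.* j)
      ≈⟨ ℤ→R-◃ (ℤ.sign i Sign.* ℤ.sign j) (ℤ.∣ i ∣ ℕ.* ℤ.∣ j ∣) ⟩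
    signR (ℤ.sign i Sign.* ℤ.sign j) * ℕ→R (ℤ.∣ i ∣ ℕ.* ℤ.∣ j ∣)
      ≈⟨ *-cong (signR-* (ℤ.sign i) (ℤ.sign j)) (ℕ→R-* ℤ.∣ i ∣ ℤ.∣ j ∣) ⟩
    (signR (ℤ.sign i) * signR (ℤ.sign j)) * (ℕ→R ℤ.∣ i ∣ * ℕ→R ℤ.∣ j ∣)
      ≈⟨ interchange _ _ _ _ ⟩
    (signR (ℤ.sign i) * ℕ→R ℤ.∣ i ∣) * (signR (ℤ.sign j) * ℕ→R ℤ.∣ j ∣)
      ≈⟨ *-cong (ℤ→R-sign-abs i) (ℤ→R-sign-abs j) ⟨
    ℤ→R i * ℤ→R j ∎

  -- The coefficient interpretation sends + 1 to 1# on the nose, so that the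
  -- constant :1 below is read back as 1# in solver goals.
  coefficient : ℤ → Carrier
  coefficient (+ suc zero) = 1#
  coefficient i            = ℤ→R i

  coefficient≈ℤ→R : ∀ i → coefficient i ≈ ℤ→R i
  coefficient≈ℤ→R (+ zero)          = refl
  coefficient≈ℤ→R (+ suc zero)      = sym (+-identityʳ _)
  coefficient≈ℤ→R (+ suc (suc n))   = refl
  coefficient≈ℤ→R -[1+ n ]          = refl

  private
    ℤ-rawRing : RawRing _ _
    ℤ-rawRing = record
      { Carrier = ℤ ; _≈_ = ≡._≡_ ; _+_ = ℤ._+_ ; _*_ = ℤ._*_ ; -_ = ℤ.-_
      ; 0# = + 0 ; 1# = + 1 }

    almostRing : AlmostCommutativeRing c ℓ
    almostRing = fromCommutativeRing R

    homo : ∀ {f : ℤ → ℤ → ℤ} {g : Carrier → Carrier → Carrier} →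
      (∀ i j → ℤ→R (f i j) ≈ g (ℤ→R i) (ℤ→R j)) → (∀ {x x' y y'} → x ≈ x' → y ≈ y' → g x y ≈ g x' y') →
      ∀ i j → coefficient (f i j) ≈ g (coefficient i) (coefficient j)
    homo {f} h g-cong i j = trans (coefficient≈ℤ→R (f i j))
      (trans (h i j) (sym (g-cong (coefficient≈ℤ→R i) (coefficient≈ℤ→R j))))

    morphism : ℤ-rawRing -Raw-AlmostCommutative⟶ almostRing
    morphism = record
      { ⟦_⟧    = coefficient
      ; +-homo = homo {ℤ._+_} ℤ→R-+ +-cong
      ; *-homo = homo {ℤ._*_} ℤ→R-* *-cong
      ; -‿homo = λ i → trans (coefficient≈ℤ→R (ℤ.- i))
                   (trans (ℤ→R-neg i) (sym (-‿cong (coefficient≈ℤ→R i))))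
      ; 0-homo = refl
      ; 1-homo = refl
      }

    coefficient≟ : ∀ i j → Maybe (coefficient i ≈ coefficient j)
    coefficient≟ i j with i ℤ.≟ j
    ... | yes ≡.refl = just refl
    ... | no _       = nothing

  open import Algebra.Solver.Ring ℤ-rawRing almostRing morphism coefficient≟ public
    using (solve; _:=_; _:+_; _:*_; _:-_; :-_; con; Polynomial)

  :0 :1 : ∀ {n} → Polynomial n
  :0 = con (+ 0)
  :1 = con (+ 1)

  -- Relations Z ≈ 0# may be used to prove X ≈ Y whenever X - Y lies in the
  -- ideal generated by Z; the witness identity X ≈ Y + K * Z is a ring identity.
  modulo : ∀ {X Y K Z} → X ≈ Y + K * Z → Z ≈ 0# → X ≈ Y
  modulo {X} {Y} {K} eq Z≈0 = trans eq (trans (+-congˡ (trans (*-congˡ Z≈0) (zeroʳ K))) (+-identityʳ Y))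

  difference≈0 : ∀ {A B} → A ≈ B → A - B ≈ 0#
  difference≈0 = x≈y⇒x∙y⁻¹≈ε

-- Binomial coefficients over ℕ, via n! = C(n,k)·k!·(n-k)!.
module BinomialCoefficients where
  open import Data.Nat
  open import Data.Nat.Properties
  open import Data.Nat.Combinatorics using (_C_; nCk≡n!/k![n-k]!; k![n∸k]!∣n!)
  open import Data.Nat.DivMod using (m/n*n≡m)
  open import Relation.Binary.PropositionalEquality
  open import Data.Nat.Tactic.RingSolver using (solve-∀)
  open ≡-Reasoning

  binom-factorials : ∀ {n k} → k ≤ n → (n C k) * (k ! * (n ∸ k) !) ≡ n !
  binom-factorials {n} {k} k≤n = begin
    (n C k) * (k ! * (n ∸ k) !)                    ≡⟨ cong (_* (k ! * (n ∸ k) !)) (nCk≡n!/k![n-k]! k≤n) ⟩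
    (n ! / (k ! * (n ∸ k) !)) * (k ! * (n ∸ k) !)   ≡⟨ m/n*n≡m (k![n∸k]!∣n! k≤n) ⟩
    n !                                            ∎
    where
    instance
      k![n∸k]!≢0 : NonZero (k ! * (n ∸ k) !)
      k![n∸k]!≢0 = k !* (n ∸ k) !≢0

  -- rebracketing that exposes (k+1)! = (k+1)·k!
  regroup : ∀ a b c d → a * b * (c * d) ≡ a * (b * c * d)
  regroup = solve-∀

  binom-absorption : ∀ {N l} → l ≤ N → (suc N C suc l) * suc l ≡ suc N * (N C l)
  binom-absorption {N} {l} l≤N = *-cancelʳ-≡ _ _ (l ! * (N ∸ l) !) (begin
    (suc N C suc l) * suc l * (l ! * (N ∸ l) !)   ≡⟨ regroup (suc N C suc l) (suc l) (l !) ((N ∸ l) !) ⟩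
    (suc N C suc l) * ((suc l) ! * (N ∸ l) !)     ≡⟨ binom-factorials {suc N} {suc l} (s≤s l≤N) ⟩
    suc N * N !                                   ≡⟨ cong (suc N *_) (binom-factorials l≤N) ⟨
    suc N * ((N C l) * (l ! * (N ∸ l) !))         ≡⟨ *-assoc (suc N) (N C l) _ ⟨
    suc N * (N C l) * (l ! * (N ∸ l) !)           ∎)
    where
    instance
      l![N∸l]!≢0 : NonZero (l ! * (N ∸ l) !)
      l![N∸l]!≢0 = l !* (N ∸ l) !≢0

  binom-step : ∀ {N j} → j < N → (N C suc j) * suc j ≡ (N C j) * (N ∸ j)
  binom-step {N} {j} j<N = *-cancelʳ-≡ _ _ (j ! * (N ∸ suc j) !) (begin
    (N C suc j) * suc j * (j ! * (N ∸ suc j) !)        ≡⟨ regroup (N C suc j) (suc j) (j !) ((N ∸ suc j) !) ⟩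
    (N C suc j) * ((suc j) ! * (N ∸ suc j) !)          ≡⟨ binom-factorials j<N ⟩
    N !                                                ≡⟨ binom-factorials (<⇒≤ j<N) ⟨
    (N C j) * (j ! * (N ∸ j) !)                        ≡⟨ cong (λ x → (N C j) * (j ! * x !)) N∸j≡1+N∸1+j ⟩
    (N C j) * (j ! * (suc (N ∸ suc j)) !)              ≡⟨ regroup′ (N C j) (j !) (suc (N ∸ suc j)) ((N ∸ suc j) !) ⟩
    (N C j) * suc (N ∸ suc j) * (j ! * (N ∸ suc j) !)  ≡⟨ cong (λ x → (N C j) * x * (j ! * (N ∸ suc j) !)) N∸j≡1+N∸1+j ⟨
    (N C j) * (N ∸ j) * (j ! * (N ∸ suc j) !)          ∎)
    where
    instance
      j![N∸1+j]!≢0 : NonZero (j ! * (N ∸ suc j) !)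
      j![N∸1+j]!≢0 = j !* (N ∸ suc j) !≢0
    N∸j≡1+N∸1+j : N ∸ j ≡ suc (N ∸ suc j)
    N∸j≡1+N∸1+j = +-∸-assoc 1 j<N
    regroup′ : ∀ a b c d → a * (b * (c * d)) ≡ a * c * (b * d)
    regroup′ = solve-∀

module FiniteSums {c ℓ : Level} (F : CharZeroField c ℓ) where
  open FieldDefs F public
  open import Relation.Binary.Reasoning.Setoid setoid
  module FieldSolver = IntegerCoefficientSolver commRing
  open FieldSolver public using () renaming (ℕ→R-+ to fromℕ-+; ℕ→R-* to fromℕ-*)
  open FieldSolver using (solve; _:=_; _:+_; _:*_; _:-_; :-_; :0; :1)

  sumTo-cong : ∀ n {f g : ℕ → Carrier} → (∀ k → k ℕ.< n → f k ≈ g k) → sumTo n f ≈ sumTo n g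
  sumTo-cong zero    f≈g = refl
  sumTo-cong (suc n) f≈g = +-cong (sumTo-cong n (λ k k<n → f≈g k (ℕ.m<n⇒m<1+n k<n))) (f≈g n ℕ.≤-refl)

  sumTo-cong′ : ∀ n {f g : ℕ → Carrier} → (∀ k → f k ≈ g k) → sumTo n f ≈ sumTo n g
  sumTo-cong′ n f≈g = sumTo-cong n (λ k _ → f≈g k)

  sumTo-+ : ∀ n (f g : ℕ → Carrier) → sumTo n (λ k → f k + g k) ≈ sumTo n f + sumTo n g
  sumTo-+ zero    f g = sym (+-identityˡ _)
  sumTo-+ (suc n) f g = trans (+-congʳ (sumTo-+ n f g))
    (solve 4 (λ a b x y → (a :+ b) :+ (x :+ y) := (a :+ x) :+ (b :+ y)) refl _ _ _ _)

  sumTo-*ˡ : ∀ n (a : Carrier) (f : ℕ → Carrier) → a * sumTo n f ≈ sumTo n (λ k → a * f k)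
  sumTo-*ˡ zero    a f = zeroʳ _
  sumTo-*ˡ (suc n) a f = trans (distribˡ _ _ _) (+-congʳ (sumTo-*ˡ n a f))

  sumTo-neg : ∀ n (f : ℕ → Carrier) → sumTo n (λ k → - f k) ≈ - sumTo n f
  sumTo-neg zero    f = solve 0 (:0 := :- :0) refl
  sumTo-neg (suc n) f = trans (+-congʳ (sumTo-neg n f)) (solve 2 (λ a b → :- a :+ :- b := :- (a :+ b)) refl _ _)

  sumTo-0 : ∀ n {f : ℕ → Carrier} → (∀ k → f k ≈ 0#) → sumTo n f ≈ 0#
  sumTo-0 zero    f≈0 = refl
  sumTo-0 (suc n) f≈0 = trans (+-cong (sumTo-0 n f≈0) (f≈0 n)) (+-identityˡ _)

  sumTo-head : ∀ n (f : ℕ → Carrier) → sumTo (suc n) f ≈ f 0 + sumTo n (λ k → f (suc k))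
  sumTo-head zero    f = trans (+-identityˡ _) (sym (+-identityʳ _))
  sumTo-head (suc n) f = trans (+-congʳ (sumTo-head n f)) (+-assoc _ _ _)

  sumTo-reverse : ∀ n (h : ℕ → Carrier) → sumTo (suc n) h ≈ sumTo (suc n) (λ k → h (n ∸ k))
  sumTo-reverse zero    h = refl
  sumTo-reverse (suc n) h = begin
    sumTo (suc n) h + h (suc n)                      ≈⟨ +-comm _ _ ⟩
    h (suc n) + sumTo (suc n) h                      ≈⟨ +-congˡ (sumTo-reverse n h) ⟩
    h (suc n) + sumTo (suc n) (λ k → h (n ∸ k))      ≈⟨ sumTo-head (suc n) (λ k → h (suc n ∸ k)) ⟨
    sumTo (suc (suc n)) (λ k → h (suc n ∸ k))        ∎

  sumTo-truncate : ∀ (f : ℕ → Carrier) n₀ L → n₀ ℕ.≤ L →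
    (∀ k → n₀ ℕ.≤ k → k ℕ.< L → f k ≈ 0#) → sumTo L f ≈ sumTo n₀ f
  sumTo-truncate f n₀ L n₀≤L vanish =
    trans (reflexive (≡.cong (λ x → sumTo x f) (≡.sym (ℕ.m∸n+n≡m n₀≤L)))) (extend (L ∸ n₀) (λ k lo hi → vanish k lo
      (≡.subst (k ℕ.<_) (ℕ.m∸n+n≡m n₀≤L) hi)))
    where
    extend : ∀ j → (∀ k → n₀ ℕ.≤ k → k ℕ.< j ℕ.+ n₀ → f k ≈ 0#) → sumTo (j ℕ.+ n₀) f ≈ sumTo n₀ f
    extend zero    _  = refl
    extend (suc j) f≈0 = trans (+-cong (extend j (λ k lo hi → f≈0 k lo (ℕ.m<n⇒m<1+n hi)))
                                         (f≈0 (j ℕ.+ n₀) (ℕ.m≤n+m n₀ j) ℕ.≤-refl))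
                               (+-identityʳ _)

  sumList-cong : ∀ (xs : List Carrier) {f g : Carrier → Carrier} → (∀ x → f x ≈ g x) →
    sumList (map f xs) ≈ sumList (map g xs)
  sumList-cong []       f≈g = refl
  sumList-cong (x ∷ xs) f≈g = +-cong (f≈g x) (sumList-cong xs f≈g)

  sumList-*ˡ : ∀ xs (v : Carrier) (f : Carrier → Carrier) → v * sumList (map f xs) ≈ sumList (map (λ b → v * f b) xs)
  sumList-*ˡ []       v f = zeroʳ v
  sumList-*ˡ (x ∷ xs) v f = trans (distribˡ _ _ _) (+-congˡ (sumList-*ˡ xs v f))

  sumList-- : ∀ xs (f g : Carrier → Carrier) → sumList (map (λ b → f b - g b) xs) ≈ sumList (map f xs) - sumList (map g xs)
  sumList-- []       f g = solve 0 (:0 := :0 :- :0) refl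
  sumList-- (x ∷ xs) f g = trans (+-congˡ (sumList-- xs f g))
    (solve 4 (λ a b c d → (a :- b) :+ (c :- d) := (a :+ c) :- (b :+ d)) refl (f x) (g x) _ _)

  sumList-const : ∀ (xs : List Carrier) (v : Carrier) → sumList (map (λ _ → v) xs) ≈ fromℕ (length xs) * v
  sumList-const []       v = sym (zeroˡ v)
  sumList-const (x ∷ xs) v = trans (+-congˡ (sumList-const xs v))
    (solve 2 (λ v n → v :+ n :* v := (:1 :+ n) :* v) refl v (fromℕ (length xs)))

module Inverses {c ℓ : Level} (F : CharZeroField c ℓ) where
  open FiniteSums F public
  open FieldSolver using (solve; _:=_; _:*_)
  open import Relation.Binary.Reasoning.Setoid setoid

  -- characteristic zero makes 1 ≠ 0, hence reciprocals are unique
  1≉0 : ¬ (1# ≈ 0#)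
  1≉0 1≈0 = charZero 0 (trans (+-identityʳ 1#) 1≈0)

  inverse-unique : ∀ {x y} → x * y ≈ 1# → y ≈ x ⁻¹
  inverse-unique {x} {y} xy≈1 = begin
    y                ≈⟨ *-identityʳ y ⟨
    y * 1#           ≈⟨ *-congˡ (⁻¹-inverse x x≉0) ⟨
    y * (x * x ⁻¹)   ≈⟨ solve 3 (λ a b c → a :* (b :* c) := (b :* a) :* c) refl y x (x ⁻¹) ⟩
    (x * y) * x ⁻¹   ≈⟨ *-congʳ xy≈1 ⟩
    1# * x ⁻¹        ≈⟨ *-identityˡ _ ⟩
    x ⁻¹             ∎
    where
    x≉0 : ¬ (x ≈ 0#)
    x≉0 x≈0 = 1≉0 (trans (sym xy≈1) (trans (*-congʳ x≈0) (zeroˡ y)))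

  inverse-cong : ∀ {x y} → ¬ (x ≈ 0#) → x ≈ y → x ⁻¹ ≈ y ⁻¹
  inverse-cong x≉0 x≈y = inverse-unique (trans (*-congʳ (sym x≈y)) (⁻¹-inverse _ x≉0))

  *-nonzero : ∀ {x y} → ¬ (x ≈ 0#) → ¬ (y ≈ 0#) → ¬ (x * y ≈ 0#)
  *-nonzero {x} {y} x≉0 y≉0 xy≈0 = y≉0 (begin
    y                  ≈⟨ *-identityˡ y ⟨
    1# * y             ≈⟨ *-congʳ (trans (*-comm _ _) (⁻¹-inverse x x≉0)) ⟨
    (x ⁻¹ * x) * y     ≈⟨ *-assoc _ _ _ ⟩
    x ⁻¹ * (x * y)     ≈⟨ *-congˡ xy≈0 ⟩
    x ⁻¹ * 0#          ≈⟨ zeroʳ _ ⟩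
    0#                 ∎)

  inverse-* : ∀ {x y} → ¬ (x ≈ 0#) → ¬ (y ≈ 0#) → (x * y) ⁻¹ ≈ x ⁻¹ * y ⁻¹
  inverse-* {x} {y} x≉0 y≉0 = sym (inverse-unique (begin
    (x * y) * (x ⁻¹ * y ⁻¹)   ≈⟨ solve 4 (λ a b c d → (a :* b) :* (c :* d) := (a :* c) :* (b :* d)) refl x y (x ⁻¹) (y ⁻¹) ⟩
    (x * x ⁻¹) * (y * y ⁻¹)   ≈⟨ *-cong (⁻¹-inverse x x≉0) (⁻¹-inverse y y≉0) ⟩
    1# * 1#                   ≈⟨ *-identityˡ _ ⟩
    1#                        ∎))

  1⁻¹≈1 : fromℕ 1 ⁻¹ ≈ 1#
  1⁻¹≈1 = sym (inverse-unique (trans (*-identityʳ _) (+-identityʳ _)))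

  suc-inverse : ∀ n → fromℕ (suc n) * fromℕ (suc n) ⁻¹ ≈ 1#
  suc-inverse n = ⁻¹-inverse _ (charZero n)

  fact-suc : ∀ n → fact (suc n) ≈ fromℕ (suc n) * fact n
  fact-suc n = fromℕ-* (suc n) (n !)

  fact-nonzero : ∀ n → ¬ (fact n ≈ 0#)
  fact-nonzero zero    = charZero 0
  fact-nonzero (suc n) n!≈0 = *-nonzero (charZero n) (fact-nonzero n) (trans (sym (fact-suc n)) n!≈0)

  fact-inverse : ∀ n → fact n * fact n ⁻¹ ≈ 1#
  fact-inverse n = ⁻¹-inverse _ (fact-nonzero n)

  fact-inverse-suc : ∀ n → fact (suc n) ⁻¹ ≈ fromℕ (suc n) ⁻¹ * fact n ⁻¹
  fact-inverse-suc n = trans (inverse-cong (fact-nonzero (suc n)) (fact-suc n)) (inverse-* (charZero n) (fact-nonzero n))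

module PowerSeries {c ℓ : Level} (F : CharZeroField c ℓ) where
  open Inverses F public
  open FieldSolver using (solve; _:=_; _:+_; _:*_; :-_)
  open import Relation.Binary.Reasoning.Setoid setoid

  -- equality of series, coefficient by coefficient; a record, so that the two
  -- sides of an equation can be inferred from its type
  infix 4 _≐_
  record _≐_ (f g : PS) : Set ℓ where
    constructor coefficientwise
    field coeff : ∀ n → f n ≈ g n
  open _≐_ public

  infixl 6 _⊕_
  _⊕_ : PS → PS → PS
  (f ⊕ g) n = f n + g n

  ⊝_ : PS → PS
  (⊝ f) n = - f n

  𝟘 : PS
  𝟘 n = 0#

  scale : Carrier → PS → PS
  scale a f n = a * f n

  infixl 7 _⊗_
  _⊗_ : PS → PS → PS
  _⊗_ = _⊛_

  PS-refl : ∀ {f} → f ≐ f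
  PS-refl = coefficientwise λ n → refl

  ≐-by-coefficients : ∀ {f g : PS} → f 0 ≈ g 0 → (∀ n → f (suc n) ≈ g (suc n)) → f ≐ g
  ≐-by-coefficients {f} {g} f₀≈g₀ fₛ≈gₛ = coefficientwise step
    where
    step : ∀ n → f n ≈ g n
    step zero    = f₀≈g₀
    step (suc n) = fₛ≈gₛ n

  ⊗-coeff₀ : ∀ (f g : PS) → (f ⊗ g) 0 ≈ f 0 * g 0
  ⊗-coeff₀ f g = +-identityˡ _

  ⊗-coeffₛ : ∀ (f g : PS) n → (f ⊗ g) (suc n) ≈ f 0 * g (suc n) + (divT f ⊗ g) n
  ⊗-coeffₛ f g n = sumTo-head (suc n) (λ k → f k * g (suc n ∸ k))

  ⊗-cong : ∀ {f f′ g g′} → f ≐ f′ → g ≐ g′ → f ⊗ g ≐ f′ ⊗ g′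
  ⊗-cong f≐f′ g≐g′ = coefficientwise (λ n → sumTo-cong′ (suc n) (λ k → *-cong (coeff f≐f′ k) (coeff g≐g′ (n ∸ k))))

  ⊗-distribʳ : ∀ f g h → (f ⊕ g) ⊗ h ≐ (f ⊗ h) ⊕ (g ⊗ h)
  ⊗-distribʳ f g h = coefficientwise (λ n → trans (sumTo-cong′ (suc n) (λ k → distribʳ _ _ _)) (sumTo-+ (suc n) _ _))

  scale-⊗ : ∀ a f g → scale a f ⊗ g ≐ scale a (f ⊗ g)
  scale-⊗ a f g = coefficientwise (λ n → trans (sumTo-cong′ (suc n) (λ k → *-assoc _ _ _)) (sym (sumTo-*ˡ (suc n) a _)))

  ⊗-comm : ∀ f g → f ⊗ g ≐ g ⊗ f
  ⊗-comm f g = coefficientwise λ n → begin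
    sumTo (suc n) (λ k → f k * g (n ∸ k))                ≈⟨ sumTo-reverse n _ ⟩
    sumTo (suc n) (λ k → f (n ∸ k) * g (n ∸ (n ∸ k)))    ≈⟨ sumTo-cong (suc n) (λ k k≤n →
        trans (*-congˡ (reflexive (≡.cong g (ℕ.m∸[m∸n]≡n (ℕ.≤-pred k≤n))))) (*-comm _ _)) ⟩
    sumTo (suc n) (λ k → g k * f (n ∸ k))                ∎

  ⊗-identityˡ : ∀ f → onePS ⊗ f ≐ f
  ⊗-identityˡ f = coefficientwise λ n → begin
    (onePS ⊗ f) n                                      ≈⟨ sumTo-head n _ ⟩
    1# * f n + sumTo n (λ k → 0# * f (n ∸ suc k))      ≈⟨ +-cong (*-identityˡ _) (sumTo-0 n (λ k → zeroˡ _)) ⟩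
    f n + 0#                                           ≈⟨ +-identityʳ _ ⟩
    f n                                                ∎

  ⊗-assoc-coeff : ∀ f g h n → ((f ⊗ g) ⊗ h) n ≈ (f ⊗ (g ⊗ h)) n
  ⊗-assoc-coeff f g h zero = begin
    ((f ⊗ g) ⊗ h) 0       ≈⟨ trans (⊗-coeff₀ (f ⊗ g) h) (*-congʳ (⊗-coeff₀ f g)) ⟩
    f 0 * g 0 * h 0       ≈⟨ *-assoc (f 0) (g 0) (h 0) ⟩
    f 0 * (g 0 * h 0)     ≈⟨ trans (⊗-coeff₀ f (g ⊗ h)) (*-congˡ (⊗-coeff₀ g h)) ⟨
    (f ⊗ (g ⊗ h)) 0       ∎
  ⊗-assoc-coeff f g h (suc n) = begin
    ((f ⊗ g) ⊗ h) (suc n)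
      ≈⟨ ⊗-coeffₛ (f ⊗ g) h n ⟩
    (f ⊗ g) 0 * h (suc n) + (divT (f ⊗ g) ⊗ h) n
      ≈⟨ +-cong (*-congʳ (⊗-coeff₀ f g)) (coeff (⊗-cong (coefficientwise (⊗-coeffₛ f g)) (PS-refl {h})) n) ⟩
    f 0 * g 0 * h (suc n) + ((scale (f 0) (divT g) ⊕ (divT f ⊗ g)) ⊗ h) n
      ≈⟨ +-congˡ (coeff (⊗-distribʳ (scale (f 0) (divT g)) (divT f ⊗ g) h) n) ⟩
    f 0 * g 0 * h (suc n) + ((scale (f 0) (divT g) ⊗ h) n + ((divT f ⊗ g) ⊗ h) n)
      ≈⟨ +-congˡ (+-cong (coeff (scale-⊗ (f 0) (divT g) h) n) (⊗-assoc-coeff (divT f) g h n)) ⟩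
    f 0 * g 0 * h (suc n) + (f 0 * (divT g ⊗ h) n + (divT f ⊗ (g ⊗ h)) n)
      ≈⟨ solve 5 (λ a b c d e → a :* b :* c :+ (a :* d :+ e) := a :* (b :* c :+ d) :+ e) refl
           (f 0) (g 0) (h (suc n)) ((divT g ⊗ h) n) ((divT f ⊗ (g ⊗ h)) n) ⟩
    f 0 * (g 0 * h (suc n) + (divT g ⊗ h) n) + (divT f ⊗ (g ⊗ h)) n
      ≈⟨ +-congʳ (*-congˡ (⊗-coeffₛ g h n)) ⟨
    f 0 * (g ⊗ h) (suc n) + (divT f ⊗ (g ⊗ h)) n
      ≈⟨ ⊗-coeffₛ f (g ⊗ h) n ⟨
    (f ⊗ (g ⊗ h)) (suc n) ∎

  ⊗-assoc : ∀ f g h → (f ⊗ g) ⊗ h ≐ f ⊗ (g ⊗ h)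
  ⊗-assoc f g h = coefficientwise (⊗-assoc-coeff f g h)

  -- series form a commutative ring; it receives the integer-coefficient solver
  powerSeriesRing : CommutativeRing c ℓ
  powerSeriesRing = record
    { Carrier = PS ; _≈_ = _≐_ ; _+_ = _⊕_ ; _*_ = _⊗_ ; -_ = ⊝_ ; 0# = 𝟘 ; 1# = onePS
    ; isCommutativeRing = record
      { isRing = record
        { +-isAbelianGroup = record
          { isGroup = record
            { isMonoid = record
              { isSemigroup = record
                { isMagma = record
                  { isEquivalence = record
                    { refl  = PS-refl
                    ; sym   = λ f≐g → coefficientwise λ n → sym (coeff f≐g n)
                    ; trans = λ f≐g g≐h → coefficientwise λ n → trans (coeff f≐g n) (coeff g≐h n) }
                  ; ∙-cong = λ f≐f′ g≐g′ → coefficientwise λ n → +-cong (coeff f≐f′ n) (coeff g≐g′ n) }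
                ; assoc = λ f g h → coefficientwise λ n → +-assoc _ _ _ }
              ; identity = (λ f → coefficientwise λ n → +-identityˡ _) , (λ f → coefficientwise λ n → +-identityʳ _) }
            ; inverse = (λ f → coefficientwise λ n → -‿inverseˡ _) , (λ f → coefficientwise λ n → -‿inverseʳ _)
            ; ⁻¹-cong = λ f≐g → coefficientwise λ n → -‿cong (coeff f≐g n) }
          ; comm = λ f g → coefficientwise λ n → +-comm _ _ }
        ; *-cong = ⊗-cong
        ; *-assoc = ⊗-assoc
        ; *-identity = ⊗-identityˡ , (λ f → coefficientwise λ n → trans (coeff (⊗-comm f onePS) n) (coeff (⊗-identityˡ f) n))
        ; distrib = (λ f g h → coefficientwise λ n → trans (coeff (⊗-comm f (g ⊕ h)) n)
                                 (trans (coeff (⊗-distribʳ g h f) n) (+-cong (coeff (⊗-comm g f) n) (coeff (⊗-comm h f) n))))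
                  , (λ h f g → ⊗-distribʳ f g h) }
      ; *-comm = ⊗-comm } }

  module PS = CommutativeRing powerSeriesRing
  module SeriesSolver = IntegerCoefficientSolver powerSeriesRing

  T : PS
  T zero    = 0#
  T (suc n) = onePS n

  T-coeff₀ : ∀ f → (T ⊗ f) 0 ≈ 0#
  T-coeff₀ f = trans (⊗-coeff₀ T f) (zeroˡ _)

  T-coeffₛ : ∀ f n → (T ⊗ f) (suc n) ≈ f n
  T-coeffₛ f n = trans (⊗-coeffₛ T f n) (trans (+-cong (zeroˡ _) (coeff (⊗-identityˡ f) n)) (+-identityˡ _))

  T-cancel : ∀ f g → T ⊗ f ≐ T ⊗ g → f ≐ g
  T-cancel f g tf≐tg = coefficientwise λ n → trans (sym (T-coeffₛ f n)) (trans (coeff tf≐tg (suc n)) (T-coeffₛ g n))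

  1+T : PS
  1+T = onePS ⊕ T

  ⊗1+T : ∀ f n → (f ⊗ 1+T) n ≈ f n + (T ⊗ f) n
  ⊗1+T f n = trans (coeff (⊗-comm f 1+T) n) (trans (coeff (⊗-distribʳ onePS T f) n) (+-congʳ (coeff (⊗-identityˡ f) n)))

  ⊗1+T-coeff₀ : ∀ f → (f ⊗ 1+T) 0 ≈ f 0
  ⊗1+T-coeff₀ f = trans (⊗1+T f 0) (trans (+-congˡ (T-coeff₀ f)) (+-identityʳ _))

  ⊗1+T-coeffₛ : ∀ f n → (f ⊗ 1+T) (suc n) ≈ f (suc n) + f n
  ⊗1+T-coeffₛ f n = trans (⊗1+T f (suc n)) (+-congˡ (T-coeffₛ f n))

  -- the Euler operator θ = t·d/dt multiplies the n-th coefficient by n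
  θ : PS → PS
  θ f n = fromℕ n * f n

  θ-cong : ∀ {f g} → f ≐ g → θ f ≐ θ g
  θ-cong f≐g = coefficientwise λ n → *-congˡ (coeff f≐g n)

  θ-⊕ : ∀ f g → θ (f ⊕ g) ≐ θ f ⊕ θ g
  θ-⊕ f g = coefficientwise λ n → distribˡ _ _ _

  θ-⊝ : ∀ f → θ (⊝ f) ≐ ⊝ θ f
  θ-⊝ f = coefficientwise λ n → solve 2 (λ a b → a :* (:- b) := :- (a :* b)) refl _ _

  θ-one : θ onePS ≐ 𝟘
  θ-one = ≐-by-coefficients (zeroˡ _) (λ n → zeroʳ _)

  θ-T : θ T ≐ T
  θ-T = ≐-by-coefficients (zeroˡ _) θ-Tₛ
    where
    θ-Tₛ : ∀ n → θ T (suc n) ≈ T (suc n)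
    θ-Tₛ zero    = trans (*-identityʳ _) (+-identityʳ _)
    θ-Tₛ (suc n) = zeroʳ _

  θ-⊗ : ∀ f g → θ (f ⊗ g) ≐ (θ f ⊗ g) ⊕ (f ⊗ θ g)
  θ-⊗ f g = coefficientwise λ n → begin
    fromℕ n * sumTo (suc n) (λ k → f k * g (n ∸ k))
      ≈⟨ sumTo-*ˡ (suc n) _ _ ⟩
    sumTo (suc n) (λ k → fromℕ n * (f k * g (n ∸ k)))
      ≈⟨ sumTo-cong (suc n) (λ k k<1+n → split n k (ℕ.≤-pred k<1+n)) ⟩
    sumTo (suc n) (λ k → fromℕ k * f k * g (n ∸ k) + f k * (fromℕ (n ∸ k) * g (n ∸ k)))
      ≈⟨ sumTo-+ (suc n) _ _ ⟩
    (θ f ⊗ g) n + (f ⊗ θ g) n ∎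
    where
    split : ∀ n k → k ℕ.≤ n → fromℕ n * (f k * g (n ∸ k)) ≈ fromℕ k * f k * g (n ∸ k) + f k * (fromℕ (n ∸ k) * g (n ∸ k))
    split n k k≤n = begin
      fromℕ n * (f k * g (n ∸ k))
        ≈⟨ *-congʳ (reflexive (≡.cong fromℕ (≡.sym (ℕ.m+[n∸m]≡n k≤n)))) ⟩
      fromℕ (k ℕ.+ (n ∸ k)) * (f k * g (n ∸ k))
        ≈⟨ *-congʳ (fromℕ-+ k (n ∸ k)) ⟩
      (fromℕ k + fromℕ (n ∸ k)) * (f k * g (n ∸ k))
        ≈⟨ solve 4 (λ a b x y → (a :+ b) :* (x :* y) := a :* x :* y :+ x :* (b :* y)) refl _ _ _ _ ⟩
      fromℕ k * f k * g (n ∸ k) + f k * (fromℕ (n ∸ k) * g (n ∸ k)) ∎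

-- The elementary series of the paper: the binomial series (1+t)^x, the
-- logarithm, reciprocals of series, and the series
--   Λ = ln(1+t)/t,  C = 1/Λ (Cauchy numbers),  G_b = ((1+t)^b - 1)/t,  H_b = 1/G_b,
-- so that the Daehee factor ln(1+t)/((1+t)^b - 1) is Λ·H_b.
module ElementarySeries {c ℓ : Level} (F : CharZeroField c ℓ) where
  open PowerSeries F public
  open FieldSolver using (solve; _:=_; _:+_; _:*_; _:-_; :-_; :0; :1; modulo; difference≈0)
  open import Relation.Binary.Reasoning.Setoid setoid

  P : Carrier → PS
  P = pow1t

  P-coeff₀ : ∀ x → P x 0 ≈ 1#
  P-coeff₀ x = trans (*-identityˡ _) 1⁻¹≈1

  falling-0 : ∀ n → falling 0# (suc n) ≈ 0#
  falling-0 zero    = trans (*-identityˡ _) (-‿inverseʳ 0#)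
  falling-0 (suc n) = trans (*-congʳ (falling-0 n)) (zeroˡ _)

  P-0 : P 0# ≐ onePS
  P-0 = ≐-by-coefficients (P-coeff₀ 0#) (λ n → trans (*-congʳ (falling-0 n)) (zeroˡ _))

  falling-−1 : ∀ n → falling (- 1#) n ≈ sgn n * fact n
  falling-−1 zero    = sym (trans (*-identityˡ _) (+-identityʳ _))
  falling-−1 (suc n) = begin
    falling (- 1#) n * (- 1# - fromℕ n)         ≈⟨ *-congʳ (falling-−1 n) ⟩
    sgn n * fact n * (- 1# - fromℕ n)           ≈⟨ solve 3 (λ s f N → s :* f :* (:- :1 :- N) := :- s :* ((:1 :+ N) :* f)) refl
                                                     (sgn n) (fact n) (fromℕ n) ⟩
    - sgn n * ((1# + fromℕ n) * fact n)         ≈⟨ *-congˡ (fact-suc n) ⟨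
    - sgn n * fact (suc n)                      ∎

  P-−1 : ∀ n → P (- 1#) n ≈ sgn n
  P-−1 n = trans (*-congʳ (falling-−1 n)) (trans (*-assoc _ _ _) (trans (*-congˡ (fact-inverse n)) (*-identityʳ _)))

  Pm : PS
  Pm = P (- 1#)

  Pm⊗1+T : Pm ⊗ 1+T ≐ onePS
  Pm⊗1+T = ≐-by-coefficients (trans (⊗1+T-coeff₀ Pm) (P-coeff₀ (- 1#)))
    (λ n → trans (⊗1+T-coeffₛ Pm n) (trans (+-cong (P-−1 (suc n)) (P-−1 n)) (-‿inverseˡ _)))

  falling-shift : ∀ b n → falling b (suc n) ≈ b * falling (b - 1#) n
  falling-shift b zero    = solve 1 (λ b → :1 :* (b :- :0) := b :* :1) refl b
  falling-shift b (suc n) = begin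
    falling b (suc n) * (b - fromℕ (suc n))             ≈⟨ *-congʳ (falling-shift b n) ⟩
    b * falling (b - 1#) n * (b - (1# + fromℕ n))       ≈⟨ solve 3 (λ b u N → b :* u :* (b :- (:1 :+ N)) := b :* (u :* ((b :- :1) :- N))) refl
                                                             b (falling (b - 1#) n) (fromℕ n) ⟩
    b * (falling (b - 1#) n * ((b - 1#) - fromℕ n))     ∎

  P-pascal : ∀ b → P (b - 1#) ⊗ 1+T ≐ P b
  P-pascal b = ≐-by-coefficients (⊗1+T-coeff₀ (P (b - 1#))) (λ n → trans (⊗1+T-coeffₛ (P (b - 1#)) n) (step n))
    where
    step : ∀ n → P (b - 1#) (suc n) + P (b - 1#) n ≈ P b (suc n)
    step n = modulo (begin
      u * ((b - 1#) - N) * fact (suc n) ⁻¹ + u * w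
        ≈⟨ +-congʳ (*-congˡ (fact-inverse-suc n)) ⟩
      u * ((b - 1#) - N) * (v * w) + u * w
        ≈⟨ solve 5 (λ u b N v w → u :* ((b :- :1) :- N) :* (v :* w) :+ u :* w
                                   := b :* u :* (v :* w) :+ (:- (u :* w)) :* ((:1 :+ N) :* v :- :1)) refl u b N v w ⟩
      b * u * (v * w) + (- (u * w)) * ((1# + N) * v - 1#)
        ≈⟨ +-congʳ (*-cong (falling-shift b n) (fact-inverse-suc n)) ⟨
      P b (suc n) + (- (u * w)) * ((1# + N) * v - 1#) ∎) (difference≈0 (suc-inverse n))
      where
      u w N v : Carrier
      u = falling (b - 1#) n
      w = fact n ⁻¹
      N = fromℕ n
      v = fromℕ (suc n) ⁻¹

  θP⊗1+T : ∀ b → θ (P b) ⊗ 1+T ≐ scale b (T ⊗ P b)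
  θP⊗1+T b = ≐-by-coefficients
    (trans (⊗1+T-coeff₀ (θ (P b))) (trans (zeroˡ _) (sym (trans (*-congˡ (T-coeff₀ (P b))) (zeroʳ _)))))
    (λ n → trans (⊗1+T-coeffₛ (θ (P b)) n) (trans (step n) (sym (*-congˡ (T-coeffₛ (P b) n)))))
    where
    step : ∀ n → θ (P b) (suc n) + θ (P b) n ≈ b * P b n
    step n = modulo (begin
      (1# + N) * (u * (b - N) * fact (suc n) ⁻¹) + N * (u * w)
        ≈⟨ +-congʳ (*-congˡ (*-congˡ (fact-inverse-suc n))) ⟩
      (1# + N) * (u * (b - N) * (v * w)) + N * (u * w)
        ≈⟨ solve 5 (λ u b N v w → (:1 :+ N) :* (u :* (b :- N) :* (v :* w)) :+ N :* (u :* w)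
                                   := b :* (u :* w) :+ (u :* (b :- N) :* w) :* ((:1 :+ N) :* v :- :1)) refl u b N v w ⟩
      b * (u * w) + (u * (b - N) * w) * ((1# + N) * v - 1#) ∎) (difference≈0 (suc-inverse n))
      where
      u w N v : Carrier
      u = falling b n
      w = fact n ⁻¹
      N = fromℕ n
      v = fromℕ (suc n) ⁻¹

  Λ : PS
  Λ = divT logPS

  Λ-coeff₀ : Λ 0 ≈ 1#
  Λ-coeff₀ = trans (*-identityˡ _) 1⁻¹≈1

  log≐TΛ : logPS ≐ T ⊗ Λ
  log≐TΛ = ≐-by-coefficients (sym (T-coeff₀ Λ)) (λ n → sym (T-coeffₛ Λ n))

  θ-log : θ logPS ≐ T ⊗ Pm
  θ-log = ≐-by-coefficients (trans (zeroʳ _) (sym (T-coeff₀ Pm))) (λ n → begin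
    fromℕ (suc n) * (sgn n * fromℕ (suc n) ⁻¹)      ≈⟨ solve 3 (λ a s i → a :* (s :* i) := s :* (a :* i)) refl _ _ _ ⟩
    sgn n * (fromℕ (suc n) * fromℕ (suc n) ⁻¹)      ≈⟨ *-congˡ (suc-inverse n) ⟩
    sgn n * 1#                                      ≈⟨ *-identityʳ _ ⟩
    sgn n                                           ≈⟨ trans (T-coeffₛ Pm n) (P-−1 n) ⟨
    (T ⊗ Pm) (suc n)                                ∎)

  -- invPS g is the reciprocal of g whenever g₀ ≠ 0: the recursion defining it
  -- computes exactly the convolution tail Σ_{i≥1} g_i h_{n-i}.
  convAux≈sum : ∀ g j n → convAux g j (invList g n) ≈ sumTo (suc n) (λ i → g (suc j ℕ.+ i) * invPS g (n ∸ i))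
  convAux≈sum g j zero = trans (+-identityʳ _)
    (sym (trans (+-identityˡ _) (*-congʳ (reflexive (≡.cong g (ℕ.+-identityʳ (suc j)))))))
  convAux≈sum g j (suc n) = begin
    g (suc j) * invPS g (suc n) + convAux g (suc j) (invList g n)
      ≈⟨ +-congˡ (convAux≈sum g (suc j) n) ⟩
    g (suc j) * invPS g (suc n) + sumTo (suc n) (λ i → g (suc (suc j) ℕ.+ i) * invPS g (n ∸ i))
      ≈⟨ +-cong (*-congʳ (reflexive (≡.cong g (ℕ.+-identityʳ (suc j)))))
                (sumTo-cong′ (suc n) (λ i → *-congʳ (reflexive (≡.cong g (ℕ.+-suc (suc j) i))))) ⟨
    g (suc j ℕ.+ 0) * invPS g (suc n) + sumTo (suc n) (λ i → g (suc j ℕ.+ suc i) * invPS g (suc n ∸ suc i))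
      ≈⟨ sumTo-head (suc n) _ ⟨
    sumTo (suc (suc n)) (λ i → g (suc j ℕ.+ i) * invPS g (suc n ∸ i)) ∎

  invPS-inverse : ∀ g → ¬ (g 0 ≈ 0#) → g ⊗ invPS g ≐ onePS
  invPS-inverse g g₀≉0 = ≐-by-coefficients (trans (⊗-coeff₀ g (invPS g)) (⁻¹-inverse _ g₀≉0)) higher
    where
    higher : ∀ n → (g ⊗ invPS g) (suc n) ≈ 0#
    higher n = trans (⊗-coeffₛ g (invPS g) n) (modulo (begin
      g 0 * (- (g 0 ⁻¹ * S)) + (divT g ⊗ invPS g) n    ≈⟨ +-congˡ (convAux≈sum g 0 n) ⟨
      g 0 * (- (g 0 ⁻¹ * S)) + S                       ≈⟨ solve 3 (λ a b s → a :* (:- (b :* s)) :+ s := :0 :+ (:- s) :* (a :* b :- :1)) refl _ _ _ ⟩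
      0# + (- S) * (g 0 * g 0 ⁻¹ - 1#)                 ∎) (difference≈0 (⁻¹-inverse _ g₀≉0)))
      where
      S : Carrier
      S = convAux g 0 (invList g n)

  C : PS
  C = invPS Λ

  ΛC≐1 : Λ ⊗ C ≐ onePS
  ΛC≐1 = invPS-inverse Λ (λ Λ₀≈0 → 1≉0 (trans (sym Λ-coeff₀) Λ₀≈0))

  G : Carrier → PS
  G b = divT (λ n → P b n - onePS n)

  TG≐P-1 : ∀ b → T ⊗ G b ≐ P b ⊕ ⊝ onePS
  TG≐P-1 b = ≐-by-coefficients (trans (T-coeff₀ (G b)) (sym (trans (+-congʳ (P-coeff₀ b)) (-‿inverseʳ _))))
                              (T-coeffₛ (G b))

  G-coeff₀ : ∀ b → G b 0 ≈ b
  G-coeff₀ b = begin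
    1# * (b - 0#) * fact 1 ⁻¹ - 0#    ≈⟨ +-cong (*-cong (solve 1 (λ b → :1 :* (b :- :0) := b) refl b) 1⁻¹≈1)
                                                (solve 0 (:- :0 := :0) refl) ⟩
    b * 1# + 0#                      ≈⟨ trans (+-identityʳ _) (*-identityʳ _) ⟩
    b                                ∎

  H : Carrier → PS
  H b = invPS (G b)

  GH≐1 : ∀ b → ¬ (b ≈ 0#) → G b ⊗ H b ≐ onePS
  GH≐1 b b≉0 = invPS-inverse (G b) (λ G₀≈0 → b≉0 (trans (sym (G-coeff₀ b)) G₀≈0))

module LogarithmicDerivatives {c ℓ : Level} (F : CharZeroField c ℓ) where
  open ElementarySeries F public
  open SeriesSolver using (solve; _:=_; _:+_; _:*_; _:-_; :-_; :0; :1; modulo; difference≈0)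
  open import Relation.Binary.Reasoning.Setoid PS.setoid

  κ : Carrier → PS
  κ b = scale b onePS

  scale≐κ⊗ : ∀ b f → scale b f ≐ κ b ⊗ f
  scale≐κ⊗ b f = PS.sym (PS.trans (scale-⊗ b onePS f) (coefficientwise λ n → *-congˡ (coeff (⊗-identityˡ f) n)))

  -- θ(t·f) = t·(f + θf), the rule used to compute θ by cancelling t
  θ-T⊗ : ∀ f → θ (T ⊗ f) ≐ T ⊗ (f ⊕ θ f)
  θ-T⊗ f = begin
    θ (T ⊗ f)                ≈⟨ θ-⊗ T f ⟩
    θ T ⊗ f ⊕ T ⊗ θ f        ≈⟨ PS.+-congʳ (PS.*-congʳ {f} θ-T) ⟩
    T ⊗ f ⊕ T ⊗ θ f          ≈⟨ PS.distribˡ T f (θ f) ⟨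
    T ⊗ (f ⊕ θ f)            ∎

  P⊗Pm : ∀ b → P b ⊗ Pm ≐ P (b - 1#)
  P⊗Pm b = begin
    P b ⊗ Pm                     ≈⟨ PS.*-congʳ {Pm} (P-pascal b) ⟨
    P (b - 1#) ⊗ 1+T ⊗ Pm        ≈⟨ solve 3 (λ p t m → p :* t :* m := p :* (m :* t)) PS.refl (P (b - 1#)) 1+T Pm ⟩
    P (b - 1#) ⊗ (Pm ⊗ 1+T)      ≈⟨ PS.*-congˡ {P (b - 1#)} Pm⊗1+T ⟩
    P (b - 1#) ⊗ onePS           ≈⟨ PS.*-identityʳ _ ⟩
    P (b - 1#)                   ∎

  -- θΛ = (1+t)^(-1) - Λ, from θ(tΛ) = θ ln(1+t) = t(1+t)^(-1)
  θΛ : θ Λ ≐ Pm ⊕ ⊝ Λ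
  θΛ = modulo {K = onePS} (solve 3 (λ u l p → u := p :- l :+ :1 :* (l :+ u :- p)) PS.refl (θ Λ) Λ Pm)
              (difference≈0 (T-cancel (Λ ⊕ θ Λ) Pm (begin
                T ⊗ (Λ ⊕ θ Λ)      ≈⟨ θ-T⊗ Λ ⟨
                θ (T ⊗ Λ)          ≈⟨ θ-cong log≐TΛ ⟨
                θ logPS            ≈⟨ θ-log ⟩
                T ⊗ Pm             ∎)))

  θP : ∀ b → θ (P b) ≐ κ b ⊗ T ⊗ P b ⊗ Pm
  θP b = begin
    θ (P b)                       ≈⟨ PS.*-identityʳ _ ⟨
    θ (P b) ⊗ onePS               ≈⟨ PS.*-congˡ {θ (P b)} Pm⊗1+T ⟨
    θ (P b) ⊗ (Pm ⊗ 1+T)          ≈⟨ solve 3 (λ d m t → d :* (m :* t) := d :* t :* m) PS.refl (θ (P b)) Pm 1+T ⟩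
    θ (P b) ⊗ 1+T ⊗ Pm            ≈⟨ PS.*-congʳ {Pm} (θP⊗1+T b) ⟩
    scale b (T ⊗ P b) ⊗ Pm        ≈⟨ PS.*-congʳ {Pm} (scale≐κ⊗ b (T ⊗ P b)) ⟩
    κ b ⊗ (T ⊗ P b) ⊗ Pm          ≈⟨ PS.*-congʳ {Pm} (PS.*-assoc (κ b) T (P b)) ⟨
    κ b ⊗ T ⊗ P b ⊗ Pm            ∎

  -- θG_b = b·(1+t)^b·(1+t)^(-1) - G_b, from θ(t·G_b) = θ((1+t)^b - 1)
  θG : ∀ b → θ (G b) ≐ κ b ⊗ P b ⊗ Pm ⊕ ⊝ G b
  θG b = modulo {K = onePS} (solve 5 (λ u g k p m → u := k :* p :* m :- g :+ :1 :* (g :+ u :- k :* p :* m)) PS.refl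
                   (θ (G b)) (G b) (κ b) (P b) Pm)
                (difference≈0 (T-cancel (G b ⊕ θ (G b)) (κ b ⊗ P b ⊗ Pm) (begin
                  T ⊗ (G b ⊕ θ (G b))              ≈⟨ θ-T⊗ (G b) ⟨
                  θ (T ⊗ G b)                      ≈⟨ θ-cong (TG≐P-1 b) ⟩
                  θ (P b ⊕ ⊝ onePS)                ≈⟨ θ-⊕ (P b) (⊝ onePS) ⟩
                  θ (P b) ⊕ θ (⊝ onePS)            ≈⟨ PS.+-congˡ (PS.trans (θ-⊝ onePS) (PS.-‿cong θ-one)) ⟩
                  θ (P b) ⊕ ⊝ 𝟘                    ≈⟨ solve 1 (λ d → d :+ :- :0 := d) PS.refl (θ (P b)) ⟩
                  θ (P b)                          ≈⟨ θP b ⟩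
                  κ b ⊗ T ⊗ P b ⊗ Pm               ≈⟨ solve 4 (λ k t p m → k :* t :* p :* m := t :* (k :* p :* m)) PS.refl (κ b) T (P b) Pm ⟩
                  T ⊗ (κ b ⊗ P b ⊗ Pm)             ∎)))

  -- θ(1/G) = -θG/G², from θ(G·H) = θ1 = 0
  θH : ∀ b → ¬ (b ≈ 0#) → θ (H b) ≐ ⊝ (θ (G b) ⊗ H b ⊗ H b)
  θH b b≉0 = modulo {K = ⊝ θ (H b)} (modulo {K = H b}
    (solve 4 (λ x g h y → x := :- (y :* h :* h) :+ (:- x) :* (g :* h :- :1) :+ h :* (y :* h :+ g :* x)) PS.refl
      (θ (H b)) (G b) (H b) (θ (G b)))
    (PS.trans (PS.sym (θ-⊗ (G b) (H b))) (PS.trans (θ-cong (GH≐1 b b≉0)) θ-one)))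
    (difference≈0 (GH≐1 b b≉0))

  Q : Carrier → PS
  Q b = C ⊗ Pm ⊗ (onePS ⊕ ⊝ (κ b ⊗ (P b ⊗ factor b)))

  θfactor : ∀ b → ¬ (b ≈ 0#) → θ (factor b) ≐ factor b ⊗ Q b
  θfactor b b≉0 = begin
    θ (Λ ⊗ H b)
      ≈⟨ θ-⊗ Λ (H b) ⟩
    θ Λ ⊗ H b ⊕ Λ ⊗ θ (H b)
      ≈⟨ PS.+-cong (PS.*-congʳ {H b} θΛ) (PS.*-congˡ {Λ} (PS.trans (θH b b≉0) (PS.-‿cong (PS.*-congʳ {H b} (PS.*-congʳ {H b} (θG b)))))) ⟩
    (Pm ⊕ ⊝ Λ) ⊗ H b ⊕ Λ ⊗ (⊝ ((κ b ⊗ P b ⊗ Pm ⊕ ⊝ G b) ⊗ H b ⊗ H b))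
      ≈⟨ modulo {K = Λ ⊗ H b} (modulo {K = ⊝ (H b ⊗ Pm ⊕ ⊝ (κ b ⊗ P b ⊗ Λ ⊗ H b ⊗ H b ⊗ Pm))} (solve 7 (λ m l h k p g c →
            (m :- l) :* h :+ l :* (:- ((k :* p :* m :- g) :* h :* h))
            := (l :* h) :* (c :* m :* (:1 :- k :* (p :* (l :* h))))
               :+ (l :* h) :* (g :* h :- :1)
               :+ (:- (h :* m :- k :* p :* l :* h :* h :* m)) :* (l :* c :- :1))
          PS.refl Pm Λ (H b) (κ b) (P b) (G b) C)
        (difference≈0 ΛC≐1)) (difference≈0 (GH≐1 b b≉0)) ⟩
    factor b ⊗ Q b ∎

  Q̂ : Carrier → PS
  Q̂ b = κ b ⊗ T ⊗ Pm ⊕ Q b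

  θfactorHat : ∀ b → ¬ (b ≈ 0#) → θ (factorHat b) ≐ factorHat b ⊗ Q̂ b
  θfactorHat b b≉0 = begin
    θ (P b ⊗ factor b)                                 ≈⟨ θ-⊗ (P b) (factor b) ⟩
    θ (P b) ⊗ factor b ⊕ P b ⊗ θ (factor b)            ≈⟨ PS.+-cong (PS.*-congʳ {factor b} (θP b)) (PS.*-congˡ {P b} (θfactor b b≉0)) ⟩
    κ b ⊗ T ⊗ P b ⊗ Pm ⊗ factor b ⊕ P b ⊗ (factor b ⊗ Q b)
      ≈⟨ solve 6 (λ k t p m f q → k :* t :* p :* m :* f :+ p :* (f :* q) := p :* f :* (k :* t :* m :+ q)) PS.refl
           (κ b) T (P b) Pm (factor b) (Q b) ⟩
    P b ⊗ factor b ⊗ Q̂ b                                ∎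

  sumPS : List Carrier → (Carrier → PS) → PS
  sumPS []       f = 𝟘
  sumPS (x ∷ xs) f = f x ⊕ sumPS xs f

  sumPS-cong : ∀ xs {f g : Carrier → PS} → (∀ b → f b ≐ g b) → sumPS xs f ≐ sumPS xs g
  sumPS-cong []       f≐g = PS.refl
  sumPS-cong (x ∷ xs) f≐g = PS.+-cong (f≐g x) (sumPS-cong xs f≐g)

  ⊗-sumPS : ∀ xs (Φ : PS) (f : Carrier → PS) → Φ ⊗ sumPS xs f ≐ sumPS xs (λ b → Φ ⊗ f b)
  ⊗-sumPS []       Φ f = PS.zeroʳ Φ
  ⊗-sumPS (x ∷ xs) Φ f = PS.trans (PS.distribˡ Φ (f x) (sumPS xs f)) (PS.+-congˡ {Φ ⊗ f x} (⊗-sumPS xs Φ f))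

  sumPS-⊕ : ∀ xs (f g : Carrier → PS) → sumPS xs (λ b → f b ⊕ g b) ≐ sumPS xs f ⊕ sumPS xs g
  sumPS-⊕ []       f g = PS.sym (PS.+-identityʳ 𝟘)
  sumPS-⊕ (x ∷ xs) f g = PS.trans (PS.+-congˡ {f x ⊕ g x} (sumPS-⊕ xs f g))
    (solve 4 (λ p q r s → (p :+ q) :+ (r :+ s) := (p :+ r) :+ (q :+ s)) PS.refl (f x) (g x) (sumPS xs f) (sumPS xs g))

  θ-product : ∀ (φ R : Carrier → PS) xs → All (λ x → ¬ (x ≈ 0#)) xs →
    (∀ b → ¬ (b ≈ 0#) → θ (φ b) ≐ φ b ⊗ R b) → θ (prodPS (map φ xs)) ≐ prodPS (map φ xs) ⊗ sumPS xs R
  θ-product φ R []       []           θφ = PS.trans θ-one (PS.sym (PS.zeroʳ onePS))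
  θ-product φ R (x ∷ xs) (x≉0 ∷ xs≉0) θφ = begin
    θ (φ x ⊗ Π)                       ≈⟨ θ-⊗ (φ x) Π ⟩
    θ (φ x) ⊗ Π ⊕ φ x ⊗ θ Π           ≈⟨ PS.+-cong (PS.*-congʳ {Π} (θφ x x≉0)) (PS.*-congˡ {φ x} (θ-product φ R xs xs≉0 θφ)) ⟩
    φ x ⊗ R x ⊗ Π ⊕ φ x ⊗ (Π ⊗ Σ)      ≈⟨ solve 4 (λ f q r s → f :* q :* r :+ f :* (r :* s) := f :* r :* (q :+ s)) PS.refl (φ x) (R x) Π Σ ⟩
    φ x ⊗ Π ⊗ (R x ⊕ Σ)               ∎
    where
    Π : PS
    Π = prodPS (map φ xs)
    Σ : PS
    Σ = sumPS xs R

  product-snoc : ∀ (φ : Carrier → PS) xs y → prodPS (map φ (xs ++ [ y ])) ≐ prodPS (map φ xs) ⊗ φ y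
  product-snoc φ []       y = PS.trans (PS.*-identityʳ (φ y)) (PS.sym (PS.*-identityˡ (φ y)))
  product-snoc φ (x ∷ xs) y = PS.trans (PS.*-congˡ {φ x} (product-snoc φ xs y)) (PS.sym (PS.*-assoc (φ x) _ (φ y)))

-- Reading off coefficients in the exponential normalisation a_k = k!·[t^k]f,
-- in which products of series become binomial convolutions.
module Coefficients {c ℓ : Level} (F : CharZeroField c ℓ) where
  open LogarithmicDerivatives F public
  open FieldSolver using (solve; _:=_; _:+_; _:*_; _:-_; :-_)
  open import Relation.Binary.Reasoning.Setoid setoid

  binomial-convolution : ∀ (f g : PS) k →
    fact k * (f ⊗ g) k ≈ sumTo (suc k) (λ i → binom k i * (fact i * f i) * (fact (k ∸ i) * g (k ∸ i)))
  binomial-convolution f g k = trans (sumTo-*ˡ (suc k) _ _) (sumTo-cong (suc k) (λ i i<1+k → term i (ℕ.≤-pred i<1+k)))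
    where
    term : ∀ i → i ℕ.≤ k → fact k * (f i * g (k ∸ i)) ≈ binom k i * (fact i * f i) * (fact (k ∸ i) * g (k ∸ i))
    term i i≤k = begin
      fact k * (f i * g (k ∸ i))
        ≈⟨ *-congʳ (reflexive (≡.cong fromℕ (≡.sym (BinomialCoefficients.binom-factorials i≤k)))) ⟩
      fromℕ ((k choose i) ℕ.* (i ! ℕ.* (k ∸ i) !)) * (f i * g (k ∸ i))
        ≈⟨ *-congʳ (trans (fromℕ-* (k choose i) _) (*-congˡ (fromℕ-* (i !) ((k ∸ i) !)))) ⟩
      binom k i * (fact i * fact (k ∸ i)) * (f i * g (k ∸ i))
        ≈⟨ solve 5 (λ b x y u v → b :* (x :* y) :* (u :* v) := b :* (x :* u) :* (y :* v)) refl _ _ _ _ _ ⟩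
      binom k i * (fact i * f i) * (fact (k ∸ i) * g (k ∸ i)) ∎

  T-coefficient : ∀ (f : PS) l → fact (suc l) * (T ⊗ f) (suc l) ≈ fromℕ (suc l) * (fact l * f l)
  T-coefficient f l = trans (*-cong (fact-suc l) (T-coeffₛ f l)) (*-assoc _ _ _)

  sumPS-coeff : ∀ xs (f : Carrier → PS) k → sumPS xs f k ≈ sumList (map (λ b → f b k) xs)
  sumPS-coeff []       f k = refl
  sumPS-coeff (x ∷ xs) f k = +-congˡ (sumPS-coeff xs f k)

  cauchy-sum-coefficient : ∀ xs (U : PS) (V : Carrier → PS) k →
    fact k * sumPS xs (λ b → C ⊗ (U ⊕ ⊝ (κ b ⊗ V b))) k
      ≈ fromℕ (length xs) * sumTo (suc k) (λ i → binom k i * cauchy i * (fact (k ∸ i) * U (k ∸ i)))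
        - sumList (map (λ b → sumTo (suc k) (λ i → binom k i * b * cauchy i * (fact (k ∸ i) * V b (k ∸ i)))) xs)
  cauchy-sum-coefficient xs U V k = begin
    fact k * sumPS xs Y k                             ≈⟨ *-congˡ (sumPS-coeff xs Y k) ⟩
    fact k * sumList (map (λ b → Y b k) xs)           ≈⟨ sumList-*ˡ xs _ _ ⟩
    sumList (map (λ b → fact k * Y b k) xs)           ≈⟨ sumList-cong xs per-factor ⟩
    sumList (map (λ b → ΣU - ΣV b) xs)                ≈⟨ sumList-- xs (λ _ → ΣU) ΣV ⟩
    sumList (map (λ _ → ΣU) xs) - sumList (map ΣV xs) ≈⟨ +-congʳ (sumList-const xs ΣU) ⟩
    fromℕ (length xs) * ΣU - sumList (map ΣV xs)      ∎
    where
    Y : Carrier → PS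
    Y b = C ⊗ (U ⊕ ⊝ (κ b ⊗ V b))
    ΣU : Carrier
    ΣU = sumTo (suc k) (λ i → binom k i * cauchy i * (fact (k ∸ i) * U (k ∸ i)))
    ΣV : Carrier → Carrier
    ΣV b = sumTo (suc k) (λ i → binom k i * b * cauchy i * (fact (k ∸ i) * V b (k ∸ i)))
    per-factor : ∀ b → fact k * Y b k ≈ ΣU - ΣV b
    per-factor b = begin
      fact k * Y b k
        ≈⟨ binomial-convolution C (U ⊕ ⊝ (κ b ⊗ V b)) k ⟩
      sumTo (suc k) (λ i → binom k i * cauchy i * (fact (k ∸ i) * (U ⊕ ⊝ (κ b ⊗ V b)) (k ∸ i)))
        ≈⟨ sumTo-cong′ (suc k) (λ i → trans (*-congˡ (scaled (k ∸ i)))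
             (solve 5 (λ B c e b g → B :* c :* (e :- b :* g) := B :* c :* e :+ :- (B :* b :* c :* g)) refl _ _ _ _ _)) ⟩
      sumTo (suc k) (λ i → binom k i * cauchy i * (fact (k ∸ i) * U (k ∸ i))
                           - binom k i * b * cauchy i * (fact (k ∸ i) * V b (k ∸ i)))
        ≈⟨ trans (sumTo-+ (suc k) _ _) (+-congˡ (sumTo-neg (suc k) _)) ⟩
      ΣU - ΣV b ∎
      where
      scaled : ∀ j → fact j * (U ⊕ ⊝ (κ b ⊗ V b)) j ≈ fact j * U j - b * (fact j * V b j)
      scaled j = trans (*-congˡ (+-congˡ (-‿cong (coeff (PS.sym (scale≐κ⊗ b (V b))) j))))
                   (solve 4 (λ f x b g → f :* (x :+ :- (b :* g)) := f :* x :- b :* (f :* g)) refl _ _ _ _)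

module StirlingTransfer {c ℓ : Level} (F : CharZeroField c ℓ) where
  open Inverses F
  open FieldSolver using (solve; _:=_; _:+_; _:*_; _:-_; :0; ℤ→R; ℤ→R-+; ℤ→R-neg; ℤ→R-*)
  open import Relation.Binary.Reasoning.Setoid setoid

  fromℤ≈ℤ→R : ∀ i → fromℤ i ≈ ℤ→R i
  fromℤ≈ℤ→R (+ n)    = refl
  fromℤ≈ℤ→R -[1+ n ] = refl

  s1-rec : ∀ j M → s1 (suc j) (suc M) ≈ s1 j M - fromℕ j * s1 j (suc M)
  s1-rec j M = begin
    fromℤ (p M ℤ.- (+ j) ℤ.* p (suc M))         ≈⟨ fromℤ≈ℤ→R (p M ℤ.- (+ j) ℤ.* p (suc M)) ⟩
    ℤ→R (p M ℤ.+ ℤ.- ((+ j) ℤ.* p (suc M)))     ≈⟨ ℤ→R-+ (p M) (ℤ.- ((+ j) ℤ.* p (suc M))) ⟩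
    ℤ→R (p M) + ℤ→R (ℤ.- ((+ j) ℤ.* p (suc M))) ≈⟨ +-congˡ (ℤ→R-neg ((+ j) ℤ.* p (suc M))) ⟩
    ℤ→R (p M) - ℤ→R ((+ j) ℤ.* p (suc M))       ≈⟨ +-congˡ (-‿cong (ℤ→R-* (+ j) (p (suc M)))) ⟩
    ℤ→R (p M) - fromℕ j * ℤ→R (p (suc M))       ≈⟨ +-cong (fromℤ≈ℤ→R (p M)) (-‿cong (*-congˡ (fromℤ≈ℤ→R (p (suc M))))) ⟨
    s1 j M - fromℕ j * s1 j (suc M)             ∎
    where
    p : ℕ → ℤ
    p = fallPoly j

  s1-vanishes : ∀ k m → k ℕ.< m → s1 k m ≈ 0#
  s1-vanishes zero    (suc m) _         = refl
  s1-vanishes (suc k) (suc m) (s≤s k<m) = begin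
    s1 (suc k) (suc m)                       ≈⟨ s1-rec k m ⟩
    s1 k m - fromℕ k * s1 k (suc m)          ≈⟨ +-cong (s1-vanishes k m k<m) (-‿cong (*-congˡ (s1-vanishes k (suc m) (ℕ.m<n⇒m<1+n k<m)))) ⟩
    0# - fromℕ k * 0#                        ≈⟨ solve 1 (λ x → :0 :- x :* :0 := :0) refl _ ⟩
    0#                                       ∎

  s1-truncate : ∀ (u v : ℕ → Carrier) (j : ℕ → ℕ) m n₀ L → n₀ ℕ.≤ L → (∀ k → n₀ ℕ.≤ k → k ℕ.< L → j k ℕ.< m) →
    sumTo L (λ l → u l * s1 (j l) m * v l) ≈ sumTo n₀ (λ l → u l * s1 (j l) m * v l)
  s1-truncate u v j m n₀ L n₀≤L small = sumTo-truncate _ n₀ L n₀≤L (λ k lo hi → begin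
    u k * s1 (j k) m * v k    ≈⟨ *-congʳ (*-congˡ (s1-vanishes (j k) m (small k lo hi))) ⟩
    u k * 0# * v k            ≈⟨ solve 2 (λ x y → x :* :0 :* y := :0) refl _ _ ⟩
    0#                        ∎)

  binom-pascal : ∀ N l → binom (suc N) (suc l) ≈ binom N l + binom N (suc l)
  binom-pascal N l = trans (reflexive (≡.cong fromℕ (≡.sym (nCk+nC[k+1]≡[n+1]C[k+1] N l)))) (fromℕ-+ (N choose l) (N choose suc l))

  binom-absorption : ∀ N l → l ℕ.≤ N → binom (suc N) (suc l) * fromℕ (suc l) ≈ fromℕ (suc N) * binom N l
  binom-absorption N l l≤N = trans (sym (fromℕ-* (suc N choose suc l) (suc l)))
    (trans (reflexive (≡.cong fromℕ (BinomialCoefficients.binom-absorption l≤N))) (fromℕ-* (suc N) (N choose l)))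

  binom-step : ∀ N l → l ℕ.< N → binom N (suc l) * fromℕ (suc l) ≈ binom N l * fromℕ (N ∸ l)
  binom-step N l l<N = trans (sym (fromℕ-* (N choose suc l) (suc l)))
    (trans (reflexive (≡.cong fromℕ (BinomialCoefficients.binom-step l<N))) (fromℕ-* (N choose l) (N ∸ l)))

  sub-pred : ∀ N l → suc N ∸ l ∸ 1 ≡.≡ N ∸ l
  sub-pred N l = ≡.trans (ℕ.∸-+-assoc (suc N) l 1) (≡.cong (suc N ∸_) (ℕ.+-comm l 1))

  ∸-bound : ∀ N M k → N ∸ M ℕ.≤ k → N ∸ k ℕ.≤ M
  ∸-bound N M k N∸M≤k = ℕ.m≤n+o⇒m∸n≤o N k (ℕ.≤-trans (ℕ.m≤n+m∸n N M)
    (ℕ.≤-trans (ℕ.+-monoʳ-≤ M N∸M≤k) (ℕ.≤-reflexive (ℕ.+-comm M k))))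

  -- In the rest of this module n = N+1 and m = M+1.
  module _ (N M : ℕ) where
    σ τ : ℕ → Carrier
    σ j = s1 j (suc M)
    τ j = s1 j M

    τ-split : ∀ j → τ j ≈ σ (suc j) + fromℕ j * σ j
    τ-split j = begin
      τ j                                  ≈⟨ solve 2 (λ t x → t := (t :- x) :+ x) refl _ _ ⟩
      (τ j - fromℕ j * σ j) + fromℕ j * σ j ≈⟨ +-congʳ (s1-rec j M) ⟨
      σ (suc j) + fromℕ j * σ j            ∎

    -- Multiplying by 1+t is transported through the Stirling transform:
    -- if d_{l+1} = e_{l+1} + (l+1)e_l then Σ C(N,l) σ(N+1-l) d_l = Σ C(N,l) τ(N-l) e_l.
    shift-identity : ∀ (d e : ℕ → Carrier) → d 0 ≈ e 0 → (∀ l → d (suc l) ≈ e (suc l) + fromℕ (suc l) * e l) →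
      sumTo (suc N) (λ l → binom N l * σ (suc N ∸ l) * d l) ≈ sumTo (suc N) (λ l → binom N l * τ (N ∸ l) * e l)
    shift-identity d e d₀ dₛ = trans expand-d (sym expand-τ)
      where
      g h k : ℕ → Carrier
      g l = binom N l * σ (suc N ∸ l) * e l
      h l = binom N (suc l) * σ (N ∸ l) * (fromℕ (suc l) * e l)
      k l = binom N l * (fromℕ (N ∸ l) * σ (N ∸ l)) * e l

      expand-d : sumTo (suc N) (λ l → binom N l * σ (suc N ∸ l) * d l) ≈ sumTo (suc N) g + sumTo N h
      expand-d = begin
        sumTo (suc N) (λ l → binom N l * σ (suc N ∸ l) * d l)
          ≈⟨ sumTo-head N _ ⟩
        binom N 0 * σ (suc N) * d 0 + sumTo N (λ l → binom N (suc l) * σ (N ∸ l) * d (suc l))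
          ≈⟨ +-cong (*-congˡ d₀) (sumTo-cong′ N (λ l → trans (*-congˡ (dₛ l)) (distribˡ _ _ _))) ⟩
        g 0 + sumTo N (λ l → g (suc l) + h l)            ≈⟨ +-congˡ (sumTo-+ N _ _) ⟩
        g 0 + (sumTo N (λ l → g (suc l)) + sumTo N h)    ≈⟨ +-assoc _ _ _ ⟨
        (g 0 + sumTo N (λ l → g (suc l))) + sumTo N h    ≈⟨ +-congʳ (sumTo-head N g) ⟨
        sumTo (suc N) g + sumTo N h                      ∎

      split : ∀ l → l ℕ.≤ N → binom N l * τ (N ∸ l) * e l ≈ g l + k l
      split l l≤N = begin
        binom N l * τ (N ∸ l) * e l
          ≈⟨ *-congʳ (*-congˡ (τ-split (N ∸ l))) ⟩
        binom N l * (σ (suc (N ∸ l)) + fromℕ (N ∸ l) * σ (N ∸ l)) * e l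
          ≈⟨ solve 4 (λ b s t e → b :* (s :+ t) :* e := b :* s :* e :+ b :* t :* e) refl _ _ _ _ ⟩
        binom N l * σ (suc (N ∸ l)) * e l + k l
          ≈⟨ +-congʳ (*-congʳ (*-congˡ (reflexive (≡.cong σ (≡.sym (ℕ.+-∸-assoc 1 l≤N)))))) ⟩
        g l + k l ∎

      h≈k : ∀ l → l ℕ.< N → h l ≈ k l
      h≈k l l<N = begin
        binom N (suc l) * σ (N ∸ l) * (fromℕ (suc l) * e l)
          ≈⟨ solve 4 (λ b s f e → b :* s :* (f :* e) := b :* f :* s :* e) refl _ _ _ _ ⟩
        binom N (suc l) * fromℕ (suc l) * σ (N ∸ l) * e l
          ≈⟨ *-congʳ (*-congʳ (binom-step N l l<N)) ⟩
        binom N l * fromℕ (N ∸ l) * σ (N ∸ l) * e l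
          ≈⟨ solve 4 (λ b f s e → b :* f :* s :* e := b :* (f :* s) :* e) refl _ _ _ _ ⟩
        k l ∎

      kN≈0 : k N ≈ 0#
      kN≈0 = begin
        binom N N * (fromℕ (N ∸ N) * σ (N ∸ N)) * e N  ≡⟨ ≡.cong (λ x → binom N N * (fromℕ x * σ (N ∸ N)) * e N) (ℕ.n∸n≡0 N) ⟩
        binom N N * (0# * σ (N ∸ N)) * e N             ≈⟨ solve 3 (λ a b c → a :* (:0 :* b) :* c := :0) refl _ _ _ ⟩
        0#                                             ∎

      expand-τ : sumTo (suc N) (λ l → binom N l * τ (N ∸ l) * e l) ≈ sumTo (suc N) g + sumTo N h
      expand-τ = begin
        sumTo (suc N) (λ l → binom N l * τ (N ∸ l) * e l) ≈⟨ sumTo-cong (suc N) (λ l l<1+N → split l (ℕ.≤-pred l<1+N)) ⟩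
        sumTo (suc N) (λ l → g l + k l)                   ≈⟨ sumTo-+ (suc N) g k ⟩
        sumTo (suc N) g + (sumTo N k + k N)               ≈⟨ +-congˡ (trans (+-congˡ kN≈0) (+-identityʳ _)) ⟩
        sumTo (suc N) g + sumTo N k                       ≈⟨ +-congˡ (sumTo-cong N (λ l l<N → h≈k l l<N)) ⟨
        sumTo (suc N) g + sumTo N h                       ∎

    pascal-split : ∀ (d : ℕ → Carrier) →
      sumTo (suc N) (λ l → binom (suc N) l * σ (suc N ∸ l) * d l)
        ≈ sumTo (suc N) (λ l → binom N l * σ (suc N ∸ l) * d l) + sumTo N (λ l → binom N l * σ (N ∸ l) * d (suc l))
    pascal-split d = begin
      sumTo (suc N) (λ l → binom (suc N) l * σ (suc N ∸ l) * d l)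
        ≈⟨ sumTo-head N _ ⟩
      binom (suc N) 0 * σ (suc N) * d 0 + sumTo N (λ l → binom (suc N) (suc l) * σ (N ∸ l) * d (suc l))
        ≈⟨ +-congˡ (trans (sumTo-cong′ N (λ l → trans (*-congʳ (*-congʳ (binom-pascal N l)))
             (solve 4 (λ p q s x → (p :+ q) :* s :* x := q :* s :* x :+ p :* s :* x) refl _ _ _ _))) (sumTo-+ N _ _)) ⟩
      binom N 0 * σ (suc N) * d 0 + (sumTo N (λ l → binom N (suc l) * σ (N ∸ l) * d (suc l)) + D₊)
        ≈⟨ +-assoc _ _ _ ⟨
      (binom N 0 * σ (suc N) * d 0 + sumTo N (λ l → binom N (suc l) * σ (N ∸ l) * d (suc l))) + D₊
        ≈⟨ +-congʳ (sumTo-head N (λ l → binom N l * σ (suc N ∸ l) * d l)) ⟨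
      sumTo (suc N) (λ l → binom N l * σ (suc N ∸ l) * d l) + D₊ ∎
      where
      D₊ : Carrier
      D₊ = sumTo N (λ l → binom N l * σ (N ∸ l) * d (suc l))

    -- absorption C(N+1,l+1)·(l+1) = (N+1)·C(N,l) turns (1/n)·X_l into d_{l+1} - W_l
    absorbed-term : ∀ (d X W : ℕ → Carrier) → (∀ l → X l + fromℕ (suc l) * W l ≈ fromℕ (suc l) * d (suc l)) →
      ∀ l → l ℕ.≤ N →
      fromℕ (suc N) ⁻¹ * (binom (suc N) (suc l) * σ (N ∸ l) * X l) ≈ binom N l * σ (N ∸ l) * (d (suc l) - W l)
    absorbed-term d X W X+W l l≤N = begin
      ni * (binom (suc N) (suc l) * σ (N ∸ l) * X l)
        ≈⟨ *-congˡ (*-congˡ X≈) ⟩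
      ni * (binom (suc N) (suc l) * σ (N ∸ l) * (fromℕ (suc l) * d (suc l) - fromℕ (suc l) * W l))
        ≈⟨ solve 6 (λ i b s f x w → i :* (b :* s :* (f :* x :- f :* w)) := i :* (b :* f) :* s :* (x :- w)) refl _ _ _ _ _ _ ⟩
      ni * (binom (suc N) (suc l) * fromℕ (suc l)) * σ (N ∸ l) * (d (suc l) - W l)
        ≈⟨ *-congʳ (*-congʳ (*-congˡ (binom-absorption N l l≤N))) ⟩
      ni * (fromℕ (suc N) * binom N l) * σ (N ∸ l) * (d (suc l) - W l)
        ≈⟨ solve 6 (λ i n b s x w → i :* (n :* b) :* s :* (x :- w) := (n :* i) :* (b :* s :* (x :- w))) refl _ _ _ _ _ _ ⟩
      (fromℕ (suc N) * ni) * (binom N l * σ (N ∸ l) * (d (suc l) - W l))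
        ≈⟨ trans (*-congʳ (suc-inverse N)) (*-identityˡ _) ⟩
      binom N l * σ (N ∸ l) * (d (suc l) - W l) ∎
      where
      ni : Carrier
      ni = fromℕ (suc N) ⁻¹
      X≈ : X l ≈ fromℕ (suc l) * d (suc l) - fromℕ (suc l) * W l
      X≈ = begin
        X l                                                 ≈⟨ solve 2 (λ x y → x := (x :+ y) :- y) refl _ _ ⟩
        (X l + fromℕ (suc l) * W l) - fromℕ (suc l) * W l   ≈⟨ +-congʳ (X+W l) ⟩
        fromℕ (suc l) * d (suc l) - fromℕ (suc l) * W l     ∎

    -- the truncated sums of Theorem 7 equal the full sums over l ≤ N,
    -- because S₁(j, m) = 0 for j < m
    lhs-range : ∀ k → suc (N ∸ M) ℕ.≤ k → k ℕ.< suc N → suc N ∸ k ℕ.< suc M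
    lhs-range (suc k) (s≤s N∸M≤k) _ = s≤s (∸-bound N M k N∸M≤k)

    τ-range : ∀ k → suc (N ∸ M) ℕ.≤ k → k ℕ.< suc N → N ∸ k ℕ.< M
    τ-range (suc k) (s≤s N∸M≤k) (s≤s k<N) = ≡.subst (ℕ._≤ M) (ℕ.+-∸-assoc 1 k<N) (∸-bound N M k N∸M≤k)

    σ-range : ∀ k → N ∸ M ℕ.≤ k → k ℕ.< N → N ∸ k ℕ.< suc M
    σ-range k N∸M≤k _ = s≤s (∸-bound N M k N∸M≤k)

    reindex : ∀ (u v : ℕ → Carrier) m L →
      sumTo L (λ l → u l * s1 (suc N ∸ l ∸ 1) m * v l) ≈ sumTo L (λ l → u l * s1 (N ∸ l) m * v l)
    reindex u v m L = sumTo-cong′ L (λ l → reflexive (≡.cong (λ j → u l * s1 j m * v l) (sub-pred N l)))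

    full-τ-sum : ∀ (u v : ℕ → Carrier) →
      sumTo (suc (N ∸ M)) (λ l → u l * s1 (suc N ∸ l ∸ 1) M * v l) ≈ sumTo (suc N) (λ l → u l * τ (N ∸ l) * v l)
    full-τ-sum u v = trans (reindex u v M (suc (N ∸ M)))
      (sym (s1-truncate u v (N ∸_) M (suc (N ∸ M)) (suc N) (s≤s (ℕ.m∸n≤m N M)) τ-range))

    full-σ-sum : ∀ (u v : ℕ → Carrier) →
      sumTo (N ∸ M) (λ l → u l * s1 (suc N ∸ l ∸ 1) (suc M) * v l) ≈ sumTo N (λ l → u l * σ (N ∸ l) * v l)
    full-σ-sum u v = trans (reindex u v (suc M) (N ∸ M))
      (sym (s1-truncate u v (N ∸_) (suc M) (N ∸ M) N (ℕ.m∸n≤m N M) σ-range))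

  stirling-transfer : ∀ N M (d e X W : ℕ → Carrier) →
    d 0 ≈ e 0 → (∀ l → d (suc l) ≈ e (suc l) + fromℕ (suc l) * e l) →
    (∀ l → X l + fromℕ (suc l) * W l ≈ fromℕ (suc l) * d (suc l)) →
    sumTo (suc (N ∸ M)) (λ l → binom (suc N) l * s1 (suc N ∸ l) (suc M) * d l)
      ≈ sumTo (suc (N ∸ M)) (λ l → binom N l * s1 (suc N ∸ l ∸ 1) M * e l)
        + fromℕ (suc N) ⁻¹ * sumTo (N ∸ M) (λ l → binom (suc N) (suc l) * s1 (suc N ∸ l ∸ 1) (suc M) * X l)
        + sumTo (N ∸ M) (λ l → binom N l * s1 (suc N ∸ l ∸ 1) (suc M) * W l)
  stirling-transfer N M d e X W d₀ dₛ X+W = begin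
    sumTo (suc (N ∸ M)) (λ l → binom (suc N) l * σ′ (suc N ∸ l) * d l)
      ≈⟨ s1-truncate (binom (suc N)) d (suc N ∸_) (suc M) (suc (N ∸ M)) (suc N) (s≤s (ℕ.m∸n≤m N M)) (lhs-range N M) ⟨
    sumTo (suc N) (λ l → binom (suc N) l * σ′ (suc N ∸ l) * d l)
      ≈⟨ pascal-split N M d ⟩
    sumTo (suc N) (λ l → binom N l * σ′ (suc N ∸ l) * d l) + sumTo N (λ l → a l * d (suc l))
      ≈⟨ +-cong (shift-identity N M d e d₀ dₛ) (sym (trans (sym (sumTo-+ N _ _)) (sumTo-cong′ N recombine))) ⟩
    sumTo (suc N) (λ l → binom N l * τ′ (N ∸ l) * e l) + (sumTo N (λ l → a l * (d (suc l) - W l)) + sumTo N (λ l → a l * W l))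
      ≈⟨ +-congˡ (+-congʳ (trans (sym (sumTo-cong N (λ l l<N → absorbed-term N M d X W X+W l (ℕ.<⇒≤ l<N)))) (sym (sumTo-*ˡ N _ _)))) ⟩
    sumTo (suc N) (λ l → binom N l * τ′ (N ∸ l) * e l)
      + (fromℕ (suc N) ⁻¹ * sumTo N (λ l → binom (suc N) (suc l) * σ′ (N ∸ l) * X l) + sumTo N (λ l → a l * W l))
      ≈⟨ +-assoc _ _ _ ⟨
    sumTo (suc N) (λ l → binom N l * τ′ (N ∸ l) * e l)
      + fromℕ (suc N) ⁻¹ * sumTo N (λ l → binom (suc N) (suc l) * σ′ (N ∸ l) * X l) + sumTo N (λ l → a l * W l)
      ≈⟨ +-cong (+-cong (full-τ-sum N M (binom N) e) (*-congˡ (full-σ-sum N M (λ l → binom (suc N) (suc l)) X)))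
                (full-σ-sum N M (binom N) W) ⟨
    sumTo (suc (N ∸ M)) (λ l → binom N l * s1 (suc N ∸ l ∸ 1) M * e l)
      + fromℕ (suc N) ⁻¹ * sumTo (N ∸ M) (λ l → binom (suc N) (suc l) * s1 (suc N ∸ l ∸ 1) (suc M) * X l)
      + sumTo (N ∸ M) (λ l → binom N l * s1 (suc N ∸ l ∸ 1) (suc M) * W l) ∎
    where
    σ′ τ′ : ℕ → Carrier
    σ′ = σ N M
    τ′ = τ N M
    a : ℕ → Carrier
    a l = binom N l * σ′ (N ∸ l)
    recombine : ∀ l → a l * (d (suc l) - W l) + a l * W l ≈ a l * d (suc l)
    recombine l = solve 3 (λ a x w → a :* (x :- w) :+ a :* w := a :* x) refl _ _ _

module DaeheeSeries {c ℓ : Level} (F : CharZeroField c ℓ)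
       (a : List (CharZeroField.Carrier F)) (a≉0 : All (λ x → ¬ (CharZeroField._≈_ F x (CharZeroField.0# F))) a) where
  open LogarithmicDerivatives F
  open SeriesSolver using (solve; _:=_; _:+_; _:*_; _:-_; :1)
  open import Relation.Binary.Reasoning.Setoid PS.setoid

  Φ : PS
  Φ = prodPS (map factor a)

  Φ⁺ : Carrier → PS
  Φ⁺ b = prodPS (map factor (a ++ [ b ]))

  θΦ : θ Φ ≐ sumPS a (λ b → C ⊗ (Φ ⊗ Pm ⊕ ⊝ (κ b ⊗ (Φ⁺ b ⊗ P (b - 1#)))))
  θΦ = begin
    θ Φ                         ≈⟨ θ-product factor Q a a≉0 θfactor ⟩
    Φ ⊗ sumPS a Q               ≈⟨ ⊗-sumPS a Φ Q ⟩
    sumPS a (λ b → Φ ⊗ Q b)     ≈⟨ sumPS-cong a per-factor ⟩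
    sumPS a (λ b → C ⊗ (Φ ⊗ Pm ⊕ ⊝ (κ b ⊗ (Φ⁺ b ⊗ P (b - 1#))))) ∎
    where
    per-factor : ∀ b → Φ ⊗ Q b ≐ C ⊗ (Φ ⊗ Pm ⊕ ⊝ (κ b ⊗ (Φ⁺ b ⊗ P (b - 1#))))
    per-factor b = begin
      Φ ⊗ (C ⊗ Pm ⊗ (onePS ⊕ ⊝ (κ b ⊗ (P b ⊗ factor b))))
        ≈⟨ solve 6 (λ f c m k p φ → f :* (c :* m :* (:1 :- k :* (p :* φ))) := c :* (f :* m :- k :* ((f :* φ) :* (p :* m))))
             PS.refl Φ C Pm (κ b) (P b) (factor b) ⟩
      C ⊗ (Φ ⊗ Pm ⊕ ⊝ (κ b ⊗ ((Φ ⊗ factor b) ⊗ (P b ⊗ Pm))))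
        ≈⟨ PS.*-congˡ {C} (PS.+-congˡ {Φ ⊗ Pm} (PS.-‿cong (PS.*-congˡ {κ b}
             (PS.*-cong (PS.sym (product-snoc factor a b)) (P⊗Pm b))))) ⟩
      C ⊗ (Φ ⊗ Pm ⊕ ⊝ (κ b ⊗ (Φ⁺ b ⊗ P (b - 1#)))) ∎

  Φ̂ : PS
  Φ̂ = prodPS (map factorHat a)

  Φ̂⁺ : Carrier → PS
  Φ̂⁺ b = prodPS (map factorHat (a ++ [ b ]))

  θΦ̂ : θ Φ̂ ≐ T ⊗ sumPS a (λ b → κ b ⊗ (Φ̂ ⊗ Pm)) ⊕ sumPS a (λ b → C ⊗ (Φ̂ ⊗ Pm ⊕ ⊝ (κ b ⊗ (Φ̂⁺ b ⊗ Pm))))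
  θΦ̂ = begin
    θ Φ̂                          ≈⟨ θ-product factorHat Q̂ a a≉0 θfactorHat ⟩
    Φ̂ ⊗ sumPS a Q̂                ≈⟨ ⊗-sumPS a Φ̂ Q̂ ⟩
    sumPS a (λ b → Φ̂ ⊗ Q̂ b)      ≈⟨ sumPS-cong a per-factor ⟩
    sumPS a (λ b → T ⊗ (κ b ⊗ (Φ̂ ⊗ Pm)) ⊕ C ⊗ (Φ̂ ⊗ Pm ⊕ ⊝ (κ b ⊗ (Φ̂⁺ b ⊗ Pm))))
                                 ≈⟨ sumPS-⊕ a _ _ ⟩
    sumPS a (λ b → T ⊗ (κ b ⊗ (Φ̂ ⊗ Pm))) ⊕ sumPS a (λ b → C ⊗ (Φ̂ ⊗ Pm ⊕ ⊝ (κ b ⊗ (Φ̂⁺ b ⊗ Pm))))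
                                 ≈⟨ PS.+-congʳ (⊗-sumPS a T (λ b → κ b ⊗ (Φ̂ ⊗ Pm))) ⟨
    T ⊗ sumPS a (λ b → κ b ⊗ (Φ̂ ⊗ Pm)) ⊕ sumPS a (λ b → C ⊗ (Φ̂ ⊗ Pm ⊕ ⊝ (κ b ⊗ (Φ̂⁺ b ⊗ Pm)))) ∎
    where
    per-factor : ∀ b → Φ̂ ⊗ Q̂ b ≐ T ⊗ (κ b ⊗ (Φ̂ ⊗ Pm)) ⊕ C ⊗ (Φ̂ ⊗ Pm ⊕ ⊝ (κ b ⊗ (Φ̂⁺ b ⊗ Pm)))
    per-factor b = begin
      Φ̂ ⊗ (κ b ⊗ T ⊗ Pm ⊕ C ⊗ Pm ⊗ (onePS ⊕ ⊝ (κ b ⊗ factorHat b)))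
        ≈⟨ solve 6 (λ f c m k t h → f :* (k :* t :* m :+ c :* m :* (:1 :- k :* h))
                                     := t :* (k :* (f :* m)) :+ c :* (f :* m :- k :* ((f :* h) :* m)))
             PS.refl Φ̂ C Pm (κ b) T (factorHat b) ⟩
      T ⊗ (κ b ⊗ (Φ̂ ⊗ Pm)) ⊕ C ⊗ (Φ̂ ⊗ Pm ⊕ ⊝ (κ b ⊗ ((Φ̂ ⊗ factorHat b) ⊗ Pm)))
        ≈⟨ PS.+-congˡ {T ⊗ (κ b ⊗ (Φ̂ ⊗ Pm))} (PS.*-congˡ {C} (PS.+-congˡ {Φ̂ ⊗ Pm} (PS.-‿cong (PS.*-congˡ {κ b}
             (PS.*-congʳ {Pm} (PS.sym (product-snoc factorHat a b))))))) ⟩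
      T ⊗ (κ b ⊗ (Φ̂ ⊗ Pm)) ⊕ C ⊗ (Φ̂ ⊗ Pm ⊕ ⊝ (κ b ⊗ (Φ̂⁺ b ⊗ Pm))) ∎

-- Theorem 7 for both kinds, obtained from stirling-transfer with
-- d_l = D_l(0|a), e_l = D_l(-1|a) and the sequences X, W read off θΦ.
module DaeheeIdentities {c ℓ : Level} (F : CharZeroField c ℓ)
       (a : List (CharZeroField.Carrier F)) (a≉0 : All (λ x → ¬ (CharZeroField._≈_ F x (CharZeroField.0# F))) a) where
  open Coefficients F
  open StirlingTransfer F using (stirling-transfer)
  open import Relation.Binary.Reasoning.Setoid setoid

  module Transfer (Φ : PS) where
    d e : ℕ → Carrier
    d k = fact k * (Φ ⊗ P 0#) k
    e k = fact k * (Φ ⊗ Pm) k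

    Φ-shift : Φ ⊗ P 0# ≐ (Φ ⊗ Pm) ⊗ 1+T
    Φ-shift = PS.trans (PS.*-congˡ {Φ} (PS.trans P-0 (PS.sym Pm⊗1+T))) (PS.sym (PS.*-assoc Φ Pm 1+T))

    d₀≈e₀ : d 0 ≈ e 0
    d₀≈e₀ = *-congˡ (trans (coeff Φ-shift 0) (⊗1+T-coeff₀ (Φ ⊗ Pm)))

    dₛ≈eₛ : ∀ l → d (suc l) ≈ e (suc l) + fromℕ (suc l) * e l
    dₛ≈eₛ l = begin
      fact (suc l) * (Φ ⊗ P 0#) (suc l)                       ≈⟨ *-congˡ (trans (coeff Φ-shift (suc l)) (⊗1+T-coeffₛ (Φ ⊗ Pm) l)) ⟩
      fact (suc l) * ((Φ ⊗ Pm) (suc l) + (Φ ⊗ Pm) l)          ≈⟨ distribˡ _ _ _ ⟩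
      e (suc l) + fact (suc l) * (Φ ⊗ Pm) l                   ≈⟨ +-congˡ (trans (*-congʳ (fact-suc l)) (*-assoc _ _ _)) ⟩
      e (suc l) + fromℕ (suc l) * e l                         ∎

    θ-coefficient : ∀ k → fact k * θ Φ k ≈ fromℕ k * d k
    θ-coefficient k = begin
      fact k * (fromℕ k * Φ k)              ≈⟨ solve 3 (λ x y w → x :* (y :* w) := y :* (x :* w)) refl _ _ _ ⟩
      fromℕ k * (fact k * Φ k)              ≈⟨ *-congˡ (*-congˡ (trans (coeff (PS.*-congˡ {Φ} P-0) k) (coeff (PS.*-identityʳ Φ) k))) ⟨
      fromℕ k * d k                         ∎
      where open FieldSolver using (solve; _:=_; _:*_)

  open DaeheeSeries F a a≉0

  module First = Transfer Φ

  X : ℕ → Carrier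
  X l = fromℕ (length a) * sumTo (suc (suc l)) (λ i → binom (suc l) i * cauchy i * D (suc l ∸ i) (- 1#) a)
        - sumList (map (λ aj → sumTo (suc (suc l)) (λ i → binom (suc l) i * aj * cauchy i
            * D (suc l ∸ i) (aj - 1#) (a ++ [ aj ]))) a)

  first-kind-relation : ∀ l → X l + fromℕ (suc l) * 0# ≈ fact (suc l) * θ Φ (suc l)
  first-kind-relation l = begin
    X l + fromℕ (suc l) * 0#
      ≈⟨ trans (+-congˡ (zeroʳ _)) (+-identityʳ _) ⟩
    X l
      ≈⟨ cauchy-sum-coefficient a (Φ ⊗ Pm) (λ b → Φ⁺ b ⊗ P (b - 1#)) (suc l) ⟨
    fact (suc l) * sumPS a (λ b → C ⊗ (Φ ⊗ Pm ⊕ ⊝ (κ b ⊗ (Φ⁺ b ⊗ P (b - 1#))))) (suc l)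
      ≈⟨ *-congˡ (coeff θΦ (suc l)) ⟨
    fact (suc l) * θ Φ (suc l) ∎

  -- the first identity of Theorem 7, with n = N+1 and m = M+1
  first-kind : ∀ N M →
    sumTo (suc (N ∸ M)) (λ l → binom (suc N) l * s1 (suc N ∸ l) (suc M) * D l 0# a)
      ≈ sumTo (suc (N ∸ M)) (λ l → binom N l * s1 (suc N ∸ l ∸ 1) M * D l (- 1#) a)
        + fromℕ (suc N) ⁻¹ * sumTo (N ∸ M) (λ l → binom (suc N) (suc l) * s1 (suc N ∸ l ∸ 1) (suc M) * X l)
  first-kind N M = begin
    sumTo (suc (N ∸ M)) (λ l → binom (suc N) l * s1 (suc N ∸ l) (suc M) * D l 0# a)
      ≈⟨ stirling-transfer N M First.d First.e X (λ _ → 0#) First.d₀≈e₀ First.dₛ≈eₛ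
           (λ l → trans (first-kind-relation l) (First.θ-coefficient (suc l))) ⟩
    A + B + sumTo (N ∸ M) (λ l → binom N l * s1 (suc N ∸ l ∸ 1) (suc M) * 0#)
      ≈⟨ +-congˡ (sumTo-0 (N ∸ M) (λ l → zeroʳ _)) ⟩
    A + B + 0#
      ≈⟨ +-identityʳ _ ⟩
    A + B ∎
    where
    A B : Carrier
    A = sumTo (suc (N ∸ M)) (λ l → binom N l * s1 (suc N ∸ l ∸ 1) M * D l (- 1#) a)
    B = fromℕ (suc N) ⁻¹ * sumTo (N ∸ M) (λ l → binom (suc N) (suc l) * s1 (suc N ∸ l ∸ 1) (suc M) * X l)

  module Second = Transfer Φ̂

  X̂ Ŵ : ℕ → Carrier
  X̂ l = fromℕ (length a) * sumTo (suc (suc l)) (λ i → binom (suc l) i * cauchy i * Dhat (suc l ∸ i) (- 1#) a)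
        - sumList (map (λ aj → sumTo (suc (suc l)) (λ i → binom (suc l) i * aj * cauchy i
            * Dhat (suc l ∸ i) (- 1#) (a ++ [ aj ]))) a)
  Ŵ l = sumList (map (λ aj → aj * Dhat l (- 1#) a) a)

  Ŵ-coefficient : ∀ l → fact (suc l) * (T ⊗ sumPS a (λ b → κ b ⊗ (Φ̂ ⊗ Pm))) (suc l) ≈ fromℕ (suc l) * Ŵ l
  Ŵ-coefficient l = begin
    fact (suc l) * (T ⊗ sumPS a (λ b → κ b ⊗ (Φ̂ ⊗ Pm))) (suc l)
      ≈⟨ T-coefficient (sumPS a (λ b → κ b ⊗ (Φ̂ ⊗ Pm))) l ⟩
    fromℕ (suc l) * (fact l * sumPS a (λ b → κ b ⊗ (Φ̂ ⊗ Pm)) l)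
      ≈⟨ *-congˡ (trans (*-congˡ (sumPS-coeff a _ l)) (sumList-*ˡ a _ _)) ⟩
    fromℕ (suc l) * sumList (map (λ b → fact l * (κ b ⊗ (Φ̂ ⊗ Pm)) l) a)
      ≈⟨ *-congˡ (sumList-cong a (λ b → trans (*-congˡ (coeff (PS.sym (scale≐κ⊗ b (Φ̂ ⊗ Pm))) l))
           (solve 3 (λ f x y → f :* (x :* y) := x :* (f :* y)) refl _ _ _))) ⟩
    fromℕ (suc l) * Ŵ l ∎
    where open FieldSolver using (solve; _:=_; _:*_)

  second-kind-relation : ∀ l → X̂ l + fromℕ (suc l) * Ŵ l ≈ fact (suc l) * θ Φ̂ (suc l)
  second-kind-relation l = begin
    X̂ l + fromℕ (suc l) * Ŵ l
      ≈⟨ +-comm _ _ ⟩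
    fromℕ (suc l) * Ŵ l + X̂ l
      ≈⟨ +-cong (Ŵ-coefficient l) (cauchy-sum-coefficient a (Φ̂ ⊗ Pm) (λ b → Φ̂⁺ b ⊗ Pm) (suc l)) ⟨
    fact (suc l) * (T ⊗ sumPS a (λ b → κ b ⊗ (Φ̂ ⊗ Pm))) (suc l)
      + fact (suc l) * sumPS a (λ b → C ⊗ (Φ̂ ⊗ Pm ⊕ ⊝ (κ b ⊗ (Φ̂⁺ b ⊗ Pm)))) (suc l)
      ≈⟨ distribˡ _ _ _ ⟨
    fact (suc l) * (T ⊗ sumPS a (λ b → κ b ⊗ (Φ̂ ⊗ Pm)) ⊕ sumPS a (λ b → C ⊗ (Φ̂ ⊗ Pm ⊕ ⊝ (κ b ⊗ (Φ̂⁺ b ⊗ Pm))))) (suc l)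
      ≈⟨ *-congˡ (coeff θΦ̂ (suc l)) ⟨
    fact (suc l) * θ Φ̂ (suc l) ∎

  -- the second identity of Theorem 7, with n = N+1 and m = M+1
  second-kind : ∀ N M →
    sumTo (suc (N ∸ M)) (λ l → binom (suc N) l * s1 (suc N ∸ l) (suc M) * Dhat l 0# a)
      ≈ sumTo (suc (N ∸ M)) (λ l → binom N l * s1 (suc N ∸ l ∸ 1) M * Dhat l (- 1#) a)
        + fromℕ (suc N) ⁻¹ * sumTo (N ∸ M) (λ l → binom (suc N) (suc l) * s1 (suc N ∸ l ∸ 1) (suc M) * X̂ l)
        + sumTo (N ∸ M) (λ l → binom N l * s1 (suc N ∸ l ∸ 1) (suc M) * Ŵ l)
  second-kind N M = stirling-transfer N M Second.d Second.e X̂ Ŵ Second.d₀≈e₀ Second.dₛ≈eₛ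
    (λ l → trans (second-kind-relation l) (Second.θ-coefficient (suc l)))

-- The hypothesis m ≤ n - 1 rules out n = 0; otherwise n = N+1, m = M+1.
theorem7 : ∀ {c ℓ : Level} (F : CharZeroField c ℓ) → let open FieldDefs F in
    (a : List Carrier) → 1 ≤ length a → All (λ x → ¬ (x ≈ 0#)) a →
    (n m : ℕ) → 1 ≤ m → m ≤ n ∸ 1 →
    (sumTo (suc (n ∸ m)) (λ l → binom n l * s1 (n ∸ l) m * D l 0# a)
      ≈ sumTo (suc (n ∸ m)) (λ l → binom (n ∸ 1) l * s1 (n ∸ l ∸ 1) (m ∸ 1) * D l (- 1#) a)
        + (fromℕ n ⁻¹) * sumTo (n ∸ m) (λ l → binom n (suc l) * s1 (n ∸ l ∸ 1) m
            * (fromℕ (length a) * sumTo (suc (suc l)) (λ i → binom (suc l) i * cauchy i * D (suc l ∸ i) (- 1#) a)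
               - sumList (map (λ aj → sumTo (suc (suc l)) (λ i → binom (suc l) i * aj * cauchy i
                   * D (suc l ∸ i) (aj - 1#) (a ++ [ aj ]))) a))))
    ×
    (sumTo (suc (n ∸ m)) (λ l → binom n l * s1 (n ∸ l) m * Dhat l 0# a)
      ≈ sumTo (suc (n ∸ m)) (λ l → binom (n ∸ 1) l * s1 (n ∸ l ∸ 1) (m ∸ 1) * Dhat l (- 1#) a)
        + (fromℕ n ⁻¹) * sumTo (n ∸ m) (λ l → binom n (suc l) * s1 (n ∸ l ∸ 1) m
            * (fromℕ (length a) * sumTo (suc (suc l)) (λ i → binom (suc l) i * cauchy i * Dhat (suc l ∸ i) (- 1#) a)
               - sumList (map (λ aj → sumTo (suc (suc l)) (λ i → binom (suc l) i * aj * cauchy i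
                   * Dhat (suc l ∸ i) (- 1#) (a ++ [ aj ]))) a)))
        + sumTo (n ∸ m) (λ l → binom (n ∸ 1) l * s1 (n ∸ l ∸ 1) m
            * sumList (map (λ aj → aj * Dhat l (- 1#) a) a)))
theorem7 F a _ a≉0 zero    (suc M) _ ()
theorem7 F a _ a≉0 (suc N) (suc M) _ _ = first-kind N M , second-kind N M
  where open DaeheeIdentities F a a≉0
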